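{- Let $\emptyset\neq\mathcal{T}\subset\Sigma_\$^+$ be a finite indexed family with total length $n$, and let $i,j\in[1..n]$ with $i<j$. If $\mathrm{L}_\mathcal{T}[i]=\mathrm{L}_\mathcal{T}[j]$, then $\mathrm{LF}[i]<\mathrm{LF}[j]$.
   Context: $\Sigma=[0..\sigma]$ integer alphabet, $\$\notin\Sigma$ smaller than every integer, $\Sigma_\$=\Sigma\cup\{\$\}$, $\infty$ larger than every integer. Strings 1-indexed; $X[..i]=X[1..i]$, $X[i..]=X[i..|X|]$; $X^\omega$ infinite concatenation. Every nonempty $X$ is $Y^k$ for a unique primitive $Y=:\mathrm{root}(X)$. $\mathrm{rot}^0(X)=X$, $\mathrm{rot}^{k+1}(X)=\mathrm{rot}^k(X)[2..]\cdot\mathrm{rot}^k(X)[1]$. $\mathrm{lcp}$ = longest common prefix length; $U<V$ iff $U$ is a proper prefix of $V$ or $U[\ell+1]<V[\ell+1]$ with $\ell=\mathrm{lcp}(U,V)$. $\mathrm{rank}_c(X,j)$ = occurrences of $c$ in $X[1..j]$. $\mathrm{PD}(V)[i]=\infty$ if $V[i]\neq\$$ and $V[i]<V[j]$ for all $j<i$; $=\$$ if $V[i]=\$$; otherwise $i-\max\{j<i:V[j]\le V[i]\}$. $\mathrm{RPD}(V)=\mathrm{PD}(V^2)[|V|+1..]$. $V\preceq_\omega U$ iff some natural $i$ has $\mathrm{PD}(V^\omega[..i])<\mathrm{PD}(U^\omega[..i])$ or $\mathrm{root}(\mathrm{RPD}(V))=\mathrm{root}(\mathrm{RPD}(U))$;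 $=_\omega$: both directions; $\prec_\omega$: $\preceq_\omega$ and not $=_\omega$. Write $\mathcal{T}=\{T_1,\dots,T_d\}$, $n_k=|T_k|$. For $i\in[1..n]$, $j$ minimal with $n_1+\dots+n_j\ge i$, $\mathrm{conj}(i)=\mathrm{rot}^{\,i-1-(n_1+\dots+n_{j-1})}(T_j)$. $\mathrm{CA}[i]=j$ iff $i-1=|\{k:\mathrm{conj}(k)\prec_\omega\mathrm{conj}(j)\text{ or }(\mathrm{conj}(k)=_\omega\mathrm{conj}(j)\wedge k<j)\}|$, $\mathrm{ICA}=\mathrm{CA}^{ -1}$; $\mathrm{prev}(i)=i-1+|\mathrm{root}(\mathrm{RPD}(T_j))|$ if $\mathrm{conj}(i)=_\omega T_j$, else $i-1$; $\mathrm{LF}[i]=\mathrm{ICA}[\mathrm{prev}(\mathrm{CA}[i])]$. $\mathrm{RTS}(V)[i]=\$$ if $V[i]=\$$, else $\mathrm{rank}_\infty(\mathrm{PD}(\mathrm{rot}^i(V)),|V|)-\mathrm{rank}_\infty(\mathrm{PD}(V[i]\cdot\mathrm{rot}^i(V))[2..],|V|)$; $\pi(V)=\mathrm{RTS}(V)[1]$. $\mathrm{L}_\mathcal{T}[i]=\pi(\mathrm{conj}(\mathrm{CA}[\mathrm{LF}[i]]))$. -}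

module Defs where

open import Data.Nat using (ℕ; zero; suc; _+_; _∸_; _≤_; _<_; _≤ᵇ_)
open import Data.Integer using (ℤ; +_; _-_)
open import Data.Bool using (Bool; true; false; if_then_else_)
open import Data.List using (List; []; _∷_; _++_; [_]; length; take; drop; concat; replicate; map)
open import Data.Nat.ListAction using (sum)
open import Data.List.Membership.Propositional using (_∈_)
open import Data.List.Relation.Unary.Unique.Propositional using (Unique)
open import Data.Product using (Σ; ∃; _×_; _,_)
open import Data.Sum using (_⊎_)
open import Function.Bundles using (_⇔_)
open import Relation.Nullary using (¬_)
open import Relation.Binary.PropositionalEquality using (_≡_; _≢_)

-- Alphabet Σ_$ : the sentinel $ (smaller than every integer) and integers

data Sym : Set where
  $   : Sym
  chr : ℕ → Sym

data InΣ$ (σ : ℕ) : Sym → Set where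
  dollar : InΣ$ σ $
  char   : ∀ {a} → a ≤ σ → InΣ$ σ (chr a)

_≤S_ : Sym → Sym → Bool
$     ≤S _     = true
chr a ≤S $     = false
chr a ≤S chr b = a ≤ᵇ b

pow : List Sym → ℕ → List Sym
pow X k = concat (replicate k X)

rot1 : List Sym → List Sym
rot1 []       = []
rot1 (x ∷ xs) = xs ++ [ x ]

rot : ℕ → List Sym → List Sym
rot zero    X = X
rot (suc k) X = rot1 (rot k X)

-- X^ω[..i]  (for nonempty X)
omegaPrefix : List Sym → ℕ → List Sym
omegaPrefix X i = take i (pow X (suc i))

-- 1-indexed lookup
nth : {A : Set} → List A → ℕ → A → A
nth []       _             d = d
nth (x ∷ xs) zero          d = d
nth (x ∷ xs) (suc zero)    d = x
nth (x ∷ xs) (suc (suc k)) d = nth xs (suc k) d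

powA : {A : Set} → List A → ℕ → List A
powA X k = concat (replicate k X)

Primitive : {A : Set} → List A → Set
Primitive {A} Z = Z ≢ [] × (∀ (Y : List A) (k : ℕ) → Z ≡ powA Y k → k ≡ 1)

IsRoot : {A : Set} → List A → List A → Set
IsRoot Y X = Primitive Y × ∃ λ k → X ≡ powA Y k

SameRoot : {A : Set} → List A → List A → Set
SameRoot X X' = ∃ λ Y → IsRoot Y X × IsRoot Y X'

data PDSym : Set where
  pd$  : PDSym
  num  : ℕ → PDSym
  pd∞  : PDSym

data _<P_ : PDSym → PDSym → Set where
  $<num : ∀ {a} → pd$ <P num a
  $<∞   : pd$ <P pd∞
  num<num : ∀ {a b} → a < b → num a <P num b
  num<∞ : ∀ {a} → num a <P pd∞

-- look back (through the reversed prefix) for the nearest j with V[j] ≤ c;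
-- return the distance i - j, or ∞ if V[i] < V[j] for all j < i
lookBack : List Sym → Sym → ℕ → PDSym
lookBack []       c d = pd∞
lookBack (y ∷ ys) c d = if y ≤S c then num d else lookBack ys c (suc d)

pdAt : List Sym → Sym → PDSym
pdAt prev $         = pd$
pdAt prev (chr a)   = lookBack prev (chr a) 1

pdGo : List Sym → List Sym → List PDSym
pdGo acc []       = []
pdGo acc (x ∷ xs) = pdAt acc x ∷ pdGo (x ∷ acc) xs

PD : List Sym → List PDSym
PD V = pdGo [] V

RPD : List Sym → List PDSym
RPD V = drop (length V) (PD (V ++ V))

data _<L_ : List PDSym → List PDSym → Set where
  prefix : ∀ {y ys} → [] <L (y ∷ ys)
  here   : ∀ {x y xs ys} → x <P y → (x ∷ xs) <L (y ∷ ys)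
  there  : ∀ {x xs ys} → xs <L ys → (x ∷ xs) <L (x ∷ ys)

_⪯ω_ : List Sym → List Sym → Set
V ⪯ω U = (∃ λ i → PD (omegaPrefix V i) <L PD (omegaPrefix U i)) ⊎ SameRoot (RPD V) (RPD U)

_=ω_ : List Sym → List Sym → Set
V =ω U = (V ⪯ω U) × (U ⪯ω V)

_≺ω_ : List Sym → List Sym → Set
V ≺ω U = (V ⪯ω U) × ¬ (V =ω U)

totalLength : List (List Sym) → ℕ
totalLength T = sum (map length T)

-- the string T_j containing global position i (j minimal with n_1+..+n_j ≥ i)
strOf : List (List Sym) → ℕ → List Sym
strOf []       i = []
strOf (t ∷ ts) i = if i ≤ᵇ length t then t else strOf ts (i ∸ length t)

-- conj(i) = rot^{i-1-(n_1+..+n_{j-1})}(T_j)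
conj : List (List Sym) → ℕ → List Sym
conj []       i = []
conj (t ∷ ts) i = if i ≤ᵇ length t then rot (i ∸ 1) t else conj ts (i ∸ length t)

InRange : ℕ → ℕ → Set
InRange n i = 1 ≤ i × i ≤ n

CountIs : ℕ → (ℕ → Set) → ℕ → Set
CountIs n P m = Σ (List ℕ) λ ks →
  Unique ks × (∀ k → (k ∈ ks) ⇔ (InRange n k × P k)) × length ks ≡ m

Before : List (List Sym) → ℕ → ℕ → Set
Before T j k = (conj T k ≺ω conj T j) ⊎ ((conj T k =ω conj T j) × k < j)

CASpec : List (List Sym) → (ℕ → ℕ) → Set
CASpec T CA = ∀ i → InRange (totalLength T) i →
  InRange (totalLength T) (CA i) ×
  (∀ j → InRange (totalLength T) j →
     (CA i ≡ j) ⇔ CountIs (totalLength T) (Before T j) (i ∸ 1))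

ICASpec : List (List Sym) → (ℕ → ℕ) → (ℕ → ℕ) → Set
ICASpec T CA ICA =
  (∀ i → InRange (totalLength T) i → ICA (CA i) ≡ i) ×
  (∀ j → InRange (totalLength T) j → InRange (totalLength T) (ICA j) × CA (ICA j) ≡ j)

PrevRel : List (List Sym) → ℕ → ℕ → Set
PrevRel T i p =
  ((conj T i =ω strOf T i) ×
     (∃ λ Y → IsRoot Y (RPD (strOf T i)) × p ≡ i ∸ 1 + length Y))
  ⊎ (¬ (conj T i =ω strOf T i) × p ≡ i ∸ 1)

IsLF : List (List Sym) → (ℕ → ℕ) → (ℕ → ℕ) → ℕ → ℕ → Set
IsLF T CA ICA i l = ∃ λ p → PrevRel T (CA i) p × ICA p ≡ l

data RSym : Set where
  r$  : RSym
  val : ℤ → RSym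

rank∞ : List PDSym → ℕ → ℕ
rank∞ X j = cnt (take j X)
  where
  cnt : List PDSym → ℕ
  cnt []         = 0
  cnt (pd∞ ∷ xs) = suc (cnt xs)
  cnt (_   ∷ xs) = cnt xs

-- RTS(V)[i]  (i ∈ [1..|V|])
RTSat : List Sym → ℕ → RSym
RTSat V i with nth V i $
... | $     = r$
... | chr c = val (+ rank∞ (PD (rot i V)) (length V)
                   - + rank∞ (drop 1 (PD (chr c ∷ rot i V))) (length V))

π : List Sym → RSym
π V = RTSat V 1

-- L_T[i] = π(conj(CA[LF[i]])), where LF[i] = l
Lval : List (List Sym) → (ℕ → ℕ) → ℕ → RSym
Lval T CA l = π (conj T (CA l))

-- CA lists the positions k in the lexicographic order of PD(conj(k)^ω), ties broken by k:
-- V ⪯ω U holds exactly when PD(V^ω) ≤ PD(U^ω) lexicographically, with equality iff V =ω U.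
-- LF sends the rank of x = CA[i] to the rank of prev(x), whose conjugate V satisfies rot1 V =ω conj(x).
-- PD(V^ω) arises from PD((rot1 V)^ω) by a shift of one step that turns some ∞ entries into
-- finite distances, and the turned ones are always the first π(V) of the ∞ entries.  Hence for
-- π(V) = π(U) the sequences PD(V^ω), PD(U^ω) compare as PD((rot1 V)^ω), PD((rot1 U)^ω) do,
-- and between ω-equal conjugates prev preserves the order of positions.  The order facts are
-- classical (trichotomy of infinite sequences, existence of primitive roots), so the argument
-- runs in the double-negation monad; the goal a < b is decidable.

module Submission where

open import Defs
open import Data.Bool using (Bool; true; false; if_then_else_; _∧_)
open import Data.Bool.Properties using (T-≡)
import Data.Integer as ℤ
import Data.Integer.Properties as ℤₚ
open import Data.List using (List; []; _∷_; _++_; [_]; length; take; drop)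
open import Data.List.Relation.Unary.All as All using (All)
open import Data.List.Relation.Unary.Any using (here; there)
open import Data.List.Membership.Propositional using (_∈_)
open import Data.List.Membership.Propositional.Properties using (∈-∃++)
open import Data.List.Relation.Unary.Unique.Propositional using (Unique; _∷_)
open import Data.List.Properties
  using (∷-injectiveˡ; ∷-injectiveʳ; ++-cancelˡ; ++-assoc; ++-identityʳ; length-++; length-take; length-drop; take++drop≡id)
open import Data.Nat
  using (ℕ; zero; suc; _+_; _*_; _∸_; _≤_; _<_; z≤n; s≤s; z<s; ≤-pred; _≟_; _≤?_; _<?_; _≤ᵇ_; _<ᵇ_; NonZero; >-nonZero⁻¹)
open import Data.Nat.DivMod using (_%_; _/_; m≡m%n+[m/n]*n; [m+n]%n≡m%n; m<n⇒m%n≡m; m%n<n)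
open import Data.Nat.Divisibility using (_∣_; divides; m%n≡0⇒n∣m)
open import Data.Nat.Properties
open import Data.List.Membership.DecPropositional _≟_ using (_∈?_)
open import Algebra.Properties.CommutativeSemigroup +-commutativeSemigroup using () renaming (interchange to +-interchange)
open import Data.Product using (∃; ∃₂; _×_; _,_; proj₁; proj₂; uncurry)
open import Data.Sum using (_⊎_; inj₁; inj₂)
open import Effect.Monad using (RawMonad)
open import Function.Bundles using (Equivalence)
open import Level using (0ℓ)
open import Relation.Binary.PropositionalEquality hiding ([_])
open import Relation.Nullary using (¬_; Dec; yes; no)
open import Relation.Binary.Definitions using (tri<; tri≈; tri>)
open import Relation.Nullary.Decidable using (decidable-stable; ¬¬-excluded-middle)
open import Relation.Nullary.Negation using (¬¬-Monad; DoubleNegation; contradiction)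

open RawMonad (¬¬-Monad {0ℓ}) using (pure; _>>=_)

private
  variable
    A : Set

-- Slices and periodic sequences

at : A → List A → ℕ → A
at d []       q       = d
at d (x ∷ xs) zero    = x
at d (x ∷ xs) (suc q) = at d xs q

at-++ˡ : (d : A) (X Y : List A) {q : ℕ} → q < length X → at d (X ++ Y) q ≡ at d X q
at-++ˡ d (x ∷ X) Y {zero}  _         = refl
at-++ˡ d (x ∷ X) Y {suc q} (s≤s q<n) = at-++ˡ d X Y q<n

at-++ʳ : (d : A) (X Y : List A) (q : ℕ) → at d (X ++ Y) (length X + q) ≡ at d Y q
at-++ʳ d []      Y q = refl
at-++ʳ d (x ∷ X) Y q = at-++ʳ d X Y q

slice : (ℕ → A) → ℕ → ℕ → List A
slice f k zero    = []
slice f k (suc m) = f k ∷ slice f (suc k) m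

length-slice : (f : ℕ → A) (k m : ℕ) → length (slice f k m) ≡ m
length-slice f k zero    = refl
length-slice f k (suc m) = cong suc (length-slice f (suc k) m)

slice-cong : {f g : ℕ → A} → f ≗ g → (k m : ℕ) → slice f k m ≡ slice g k m
slice-cong f≗g k zero    = refl
slice-cong f≗g k (suc m) = cong₂ _∷_ (f≗g k) (slice-cong f≗g (suc k) m)

slice-cong-< : {f g : ℕ → A} (m : ℕ) → (∀ q → q < m → f q ≡ g q) → slice f 0 m ≡ slice g 0 m
slice-cong-< {f = f} {g} m agree = go 0 m (λ q q<m → agree q q<m)
  where
  go : ∀ k n → (∀ q → q < k + n → f q ≡ g q) → slice f k n ≡ slice g k n
  go k zero    _     = refl
  go k (suc n) agree′ = cong₂ _∷_ (agree′ k (m<m+n k z<s))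
                                   (go (suc k) n (λ q lt → agree′ q (subst (q <_) (sym (+-suc k n)) lt)))

slice-shift : (f : ℕ → A) (k m : ℕ) → slice f k m ≡ slice (λ q → f (k + q)) 0 m
slice-shift f k m = trans (cong (λ z → slice f z m) (sym (+-identityʳ k))) (go 0 m)
  where
  go : ∀ j n → slice f (k + j) n ≡ slice (λ q → f (k + q)) j n
  go j zero    = refl
  go j (suc n) = cong (f (k + j) ∷_) (trans (cong (λ z → slice f z n) (sym (+-suc k j))) (go (suc j) n))

slice-++ : (f : ℕ → A) (k m n : ℕ) → slice f k (m + n) ≡ slice f k m ++ slice f (k + m) n
slice-++ f k zero    n = cong (λ z → slice f z n) (sym (+-identityʳ k))
slice-++ f k (suc m) n = cong (f k ∷_) (trans (slice-++ f (suc k) m n) (cong (λ z → slice f (suc k) m ++ slice f z n) (sym (+-suc k m))))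

take-slice : (f : ℕ → A) (k : ℕ) {i m : ℕ} → i ≤ m → take i (slice f k m) ≡ slice f k i
take-slice f k {zero}              _         = refl
take-slice f k {suc i} {suc m} (s≤s i≤m) = cong (f k ∷_) (take-slice f (suc k) i≤m)

drop-slice : (f : ℕ → A) (k i m : ℕ) → drop i (slice f k (i + m)) ≡ slice f (k + i) m
drop-slice f k zero    m = cong (λ z → slice f z m) (sym (+-identityʳ k))
drop-slice f k (suc i) m = trans (drop-slice f (suc k) i m) (cong (λ z → slice f z m) (sym (+-suc k i)))

at-slice : (d : A) (f : ℕ → A) (k : ℕ) {m q : ℕ} → q < m → at d (slice f k m) q ≡ f (k + q)
at-slice d f k {suc m} {zero}  _         = cong f (sym (+-identityʳ k))
at-slice d f k {suc m} {suc q} (s≤s q<m) = trans (at-slice d f (suc k) q<m) (cong f (sym (+-suc k q)))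

slice-at : (d : A) (X : List A) → slice (at d X) 0 (length X) ≡ X
slice-at d []       = refl
slice-at d (x ∷ xs) = cong (x ∷_) (trans (slice-shift (at d (x ∷ xs)) 1 (length xs)) (slice-at d xs))

Periodic : ℕ → (ℕ → A) → Set
Periodic N f = ∀ q → f (N + q) ≡ f q

periodic-* : {N : ℕ} {f : ℕ → A} → Periodic N f → ∀ k q → f (k * N + q) ≡ f q
periodic-*             per zero    q = refl
periodic-* {N = N} {f} per (suc k) q = trans (cong f (+-assoc N (k * N) q)) (trans (per _) (periodic-* per k q))

periodic-% : {N : ℕ} {f : ℕ → A} .{{_ : NonZero N}} → Periodic N f → ∀ q → f q ≡ f (q % N)
periodic-% {N = N} {f} per q = begin
  f q                   ≡⟨ cong f (m≡m%n+[m/n]*n q N) ⟩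
  f (q % N + q / N * N) ≡⟨ cong f (+-comm (q % N) _) ⟩
  f (q / N * N + q % N) ≡⟨ periodic-* per (q / N) (q % N) ⟩
  f (q % N)             ∎
  where open ≡-Reasoning

periodic-≗ : {N : ℕ} {f g : ℕ → A} .{{_ : NonZero N}} → Periodic N f → Periodic N g →
             (∀ q → q < N → f q ≡ g q) → f ≗ g
periodic-≗ {N = N} per-f per-g agree q =
  trans (periodic-% per-f q) (trans (agree _ (m%n<n q N)) (sym (periodic-% per-g q)))

slice-periodic : {N : ℕ} {f : ℕ → A} → Periodic N f → (k m : ℕ) → slice f (k + N) m ≡ slice f k m
slice-periodic             per k zero    = refl
slice-periodic {N = N} {f} per k (suc m) = cong₂ _∷_ (trans (cong f (+-comm k N)) (per k)) (slice-periodic per (suc k) m)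

omegaAt : A → List A → ℕ → A
omegaAt d []          q = d
omegaAt d X@(_ ∷ _) q = at d X (q % length X)

length-nonZero : {X : List A} → X ≢ [] → NonZero (length X)
length-nonZero {X = []}    X≢[] = contradiction refl X≢[]
length-nonZero {X = _ ∷ _} _    = _

omegaAt-< : (d : A) (X : List A) {q : ℕ} → q < length X → omegaAt d X q ≡ at d X q
omegaAt-< d X@(_ ∷ _) q<n = cong (at d X) (m<n⇒m%n≡m q<n)

omegaAt-periodic : (d : A) (X : List A) → Periodic (length X) (omegaAt d X)
omegaAt-periodic d []          q = refl
omegaAt-periodic d X@(_ ∷ _) q =
  cong (at d X) (trans (cong (_% length X) (+-comm (length X) q)) ([m+n]%n≡m%n q (length X)))

slice-omegaAt : (d : A) (X : List A) → slice (omegaAt d X) 0 (length X) ≡ X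
slice-omegaAt d X = trans (slice-cong-< (length X) (λ q → omegaAt-< d X)) (slice-at d X)

length-powA : (X : List A) (k : ℕ) → length (powA X k) ≡ k * length X
length-powA X zero    = refl
length-powA X (suc k) = trans (length-++ X) (cong (length X +_) (length-powA X k))

powA-+ : (X : List A) (a b : ℕ) → powA X (a + b) ≡ powA X a ++ powA X b
powA-+ X zero    b = refl
powA-+ X (suc a) b = trans (cong (X ++_) (powA-+ X a b)) (sym (++-assoc X (powA X a) (powA X b)))

powA-* : (X : List A) (c k : ℕ) → powA (powA X c) k ≡ powA X (k * c)
powA-* X c zero    = refl
powA-* X c (suc k) = trans (cong (powA X c ++_) (powA-* X c k)) (sym (powA-+ X c (k * c)))

powA-1 : (X : List A) → powA X 1 ≡ X
powA-1 = ++-identityʳ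

powA-slice : (d : A) (X : List A) (k : ℕ) → powA X k ≡ slice (omegaAt d X) 0 (k * length X)
powA-slice d X zero    = refl
powA-slice d X (suc k) = sym (begin
  slice ω 0 (length X + k * length X)           ≡⟨ slice-++ ω 0 (length X) (k * length X) ⟩
  slice ω 0 (length X) ++ slice ω (length X) (k * length X)
    ≡⟨ cong₂ _++_ (slice-omegaAt d X) (slice-periodic (omegaAt-periodic d X) 0 (k * length X)) ⟩
  X ++ slice ω 0 (k * length X)                  ≡⟨ cong (X ++_) (sym (powA-slice d X k)) ⟩
  X ++ powA X k                                  ∎)
  where
  ω = omegaAt d X
  open ≡-Reasoning

omegaAt-powA : (d : A) {X : List A} (Z : List A) (k : ℕ) → X ≡ powA Z k → X ≢ [] → omegaAt d X ≗ omegaAt d Z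
omegaAt-powA d {X} Z k refl X≢[] =
  periodic-≗ {{length-nonZero X≢[]}} (omegaAt-periodic d X) per-Z agree
  where
  per-Z : Periodic (length X) (omegaAt d Z)
  per-Z q = trans (cong (λ n → omegaAt d Z (n + q)) (length-powA Z k))
                  (periodic-* (omegaAt-periodic d Z) k q)
  agree : ∀ q → q < length X → omegaAt d X q ≡ omegaAt d Z q
  agree q q<n = begin
    omegaAt d X q                          ≡⟨ omegaAt-< d X q<n ⟩
    at d X q                               ≡⟨ cong (λ Y → at d Y q) (powA-slice d Z k) ⟩
    at d (slice (omegaAt d Z) 0 (k * length Z)) q
      ≡⟨ at-slice d (omegaAt d Z) 0 (subst (q <_) (length-powA Z k) q<n) ⟩
    omegaAt d Z q                          ∎
    where open ≡-Reasoning

++-slice : (d : A) (X Y : List A) → omegaAt d X ≗ omegaAt d Y →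
           X ++ Y ≡ slice (omegaAt d X) 0 (length X + length Y)
++-slice d X Y X≗Y = sym (begin
  slice ω 0 (length X + length Y)                       ≡⟨ slice-++ ω 0 (length X) (length Y) ⟩
  slice ω 0 (length X) ++ slice ω (length X) (length Y)
    ≡⟨ cong₂ _++_ (slice-omegaAt d X) (slice-periodic (omegaAt-periodic d X) 0 (length Y)) ⟩
  X ++ slice ω 0 (length Y)                             ≡⟨ cong (X ++_) (slice-cong X≗Y 0 (length Y)) ⟩
  X ++ slice (omegaAt d Y) 0 (length Y)                 ≡⟨ cong (X ++_) (slice-omegaAt d Y) ⟩
  X ++ Y                                                ∎)
  where
  ω = omegaAt d X
  open ≡-Reasoning

omegaAt-≗⇒comm : (d : A) (X Y : List A) → omegaAt d X ≗ omegaAt d Y → X ++ Y ≡ Y ++ X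
omegaAt-≗⇒comm d X Y X≗Y = begin
  X ++ Y                                        ≡⟨ ++-slice d X Y X≗Y ⟩
  slice (omegaAt d X) 0 (length X + length Y)   ≡⟨ cong (slice (omegaAt d X) 0) (+-comm (length X) (length Y)) ⟩
  slice (omegaAt d X) 0 (length Y + length X)   ≡⟨ slice-cong X≗Y 0 _ ⟩
  slice (omegaAt d Y) 0 (length Y + length X)   ≡⟨ ++-slice d Y X (λ q → sym (X≗Y q)) ⟨
  Y ++ X                                        ∎
  where open ≡-Reasoning

-- Commuting words and primitive roots

prefix-of-++ : (xs ys us vs : List A) → xs ++ ys ≡ us ++ vs → length xs ≤ length us → ∃ λ w → us ≡ xs ++ w
prefix-of-++ []       ys us       vs eq _           = us , refl
prefix-of-++ (x ∷ xs) ys (u ∷ us) vs eq (s≤s len≤) with prefix-of-++ xs ys us vs (∷-injectiveʳ eq) len≤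
... | w , refl = w , cong (_∷ xs ++ w) (sym (∷-injectiveˡ eq))

CommonBase : List A → List A → Set
CommonBase {A} X Y = ∃ λ (Z : List A) → ∃₂ λ a b → X ≡ powA Z a × Y ≡ powA Z b

comm⇒commonBase : (X Y : List A) → X ++ Y ≡ Y ++ X → CommonBase X Y
comm⇒commonBase {A} X Y comm = go (length X + length Y) X Y comm ≤-refl
  where
  go : ∀ fuel (X Y : List A) → X ++ Y ≡ Y ++ X → length X + length Y ≤ fuel → CommonBase X Y
  go _ [] Y _ _ = Y , 0 , 1 , refl , sym (powA-1 Y)
  go _ X@(_ ∷ _) [] _ _ = X , 1 , 0 , sym (powA-1 X) , refl
  go (suc fuel) X@(_ ∷ _) Y@(_ ∷ _) comm bound with length X ≤? length Y
  ... | yes X≤Y with prefix-of-++ X Y Y X comm X≤Y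
  ...   | W , refl with go fuel X W (++-cancelˡ X _ _ (trans comm (++-assoc X W X))) shorter
    where
    shorter : length X + length W ≤ fuel
    shorter = ≤-pred (≤-trans (+-monoʳ-< (length X) (subst (length W <_) (sym (length-++ X)) (m<n+m _ z<s))) bound)
  ...     | Z , a , b , X≡ , W≡ = Z , a , a + b , X≡ , trans (cong₂ _++_ X≡ W≡) (sym (powA-+ Z a b))
  go (suc fuel) X@(_ ∷ _) Y@(_ ∷ _) comm bound | no X≰Y
    with prefix-of-++ Y X X Y (sym comm) (<⇒≤ (≰⇒> X≰Y))
  ... | W , refl with go fuel W Y (sym (++-cancelˡ Y _ _ (trans (sym comm) (++-assoc Y W Y)))) shorter
    where
    shorter : length W + length Y ≤ fuel
    shorter = ≤-pred (≤-trans (+-monoˡ-< (length Y) (subst (length W <_) (sym (length-++ Y)) (m<n+m _ z<s))) bound)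
  ...   | Z , a , b , W≡ , Y≡ = Z , b + a , b , trans (cong₂ _++_ Y≡ W≡) (sym (powA-+ Z b a)) , Y≡

powA-[] : (k : ℕ) → powA {A} [] k ≡ []
powA-[] zero    = refl
powA-[] (suc k) = powA-[] k

¬primitive⇒properPower : {Z : List A} → Z ≢ [] → ¬ Primitive Z →
                         DoubleNegation (∃₂ λ Y k → Z ≡ powA Y k × k ≢ 1)
¬primitive⇒properPower Z≢[] ¬prim ¬power =
  ¬prim (Z≢[] , λ Y k Z≡Yᵏ → decidable-stable (k ≟ 1) (λ k≢1 → ¬power (Y , k , Z≡Yᵏ , k≢1)))

¬¬-root : (Z : List A) → Z ≢ [] → DoubleNegation (∃ λ Y → IsRoot Y Z)
¬¬-root {A} Z Z≢[] = go (suc (length Z)) Z Z≢[] ≤-refl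
  where
  go : ∀ fuel (Z : List A) → Z ≢ [] → length Z < fuel → DoubleNegation (∃ λ Y → IsRoot Y Z)
  go (suc fuel) Z Z≢[] bound = ¬¬-excluded-middle >>= decide
    where
    descend : ∀ Y k → Z ≡ powA Y k → k ≢ 1 → DoubleNegation (∃ λ R → IsRoot R Z)
    descend Y       zero          Z≡Yᵏ _   = contradiction Z≡Yᵏ Z≢[]
    descend Y       (suc zero)    _    k≢1 = contradiction refl k≢1
    descend []      (suc (suc k)) Z≡Yᵏ _   = contradiction (trans Z≡Yᵏ (powA-[] (suc (suc k)))) Z≢[]
    descend Y@(_ ∷ _) (suc (suc k)) Z≡Yᵏ _ = do
      (R , prim , c , Y≡Rᶜ) ← go fuel Y (λ ()) Y<fuel
      pure (R , prim , suc (suc k) * c ,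
            trans Z≡Yᵏ (trans (cong (λ X → powA X (suc (suc k))) Y≡Rᶜ) (powA-* R c (suc (suc k)))))
      where
      Y<fuel : length Y < fuel
      Y<fuel = <-≤-trans (subst (length Y <_) (sym (trans (cong length Z≡Yᵏ) (length-powA Y (suc (suc k)))))
                                (m<m+n (length Y) z<s))
                         (≤-pred bound)
    decide : Dec (Primitive Z) → DoubleNegation (∃ λ R → IsRoot R Z)
    decide (yes prim) = pure (Z , prim , 1 , sym (powA-1 Z))
    decide (no ¬prim) = do
      (Y , k , Z≡Yᵏ , k≢1) ← ¬primitive⇒properPower Z≢[] ¬prim
      descend Y k Z≡Yᵏ k≢1

root-unique : (d : A) {X Y₁ Y₂ : List A} → X ≢ [] → IsRoot Y₁ X → IsRoot Y₂ X → Y₁ ≡ Y₂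
root-unique d {X} {Y₁} {Y₂} X≢[] (prim₁ , k₁ , X≡₁) (prim₂ , k₂ , X≡₂)
  with comm⇒commonBase Y₁ Y₂ (omegaAt-≗⇒comm d Y₁ Y₂ same-ω)
  where
  same-ω : omegaAt d Y₁ ≗ omegaAt d Y₂
  same-ω q = trans (sym (omegaAt-powA d Y₁ k₁ X≡₁ X≢[] q)) (omegaAt-powA d Y₂ k₂ X≡₂ X≢[] q)
... | Z , a , b , Y₁≡ , Y₂≡ with proj₂ prim₁ Z a Y₁≡ | proj₂ prim₂ Z b Y₂≡
... | refl | refl = trans Y₁≡ (sym Y₂≡)

rotation-slice : (d : A) (Y : List A) {s : ℕ} → s ≤ length Y →
                 drop s Y ++ take s Y ≡ slice (omegaAt d Y) s (length Y)
rotation-slice d Y {s} s≤n = begin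
  drop s Y ++ take s Y                  ≡⟨ cong₂ (λ U V → drop s U ++ take s V) Y≡ Y≡ ⟩
  drop s (slice ω 0 (s + t)) ++ take s (slice ω 0 (s + t))
    ≡⟨ cong₂ _++_ (drop-slice ω 0 s t) (take-slice ω 0 (m≤m+n s t)) ⟩
  slice ω s t ++ slice ω 0 s            ≡⟨ cong (slice ω s t ++_) (sym (slice-periodic (omegaAt-periodic d Y) 0 s)) ⟩
  slice ω s t ++ slice ω (length Y) s   ≡⟨ cong (λ n → slice ω s t ++ slice ω n s) (sym s+t≡n) ⟩
  slice ω s t ++ slice ω (s + t) s      ≡⟨ slice-++ ω s t s ⟨
  slice ω s (t + s)                     ≡⟨ cong (slice ω s) (trans (+-comm t s) s+t≡n) ⟩
  slice ω s (length Y)                  ∎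
  where
  open ≡-Reasoning
  ω = omegaAt d Y
  t = length Y ∸ s
  s+t≡n : s + t ≡ length Y
  s+t≡n = m+[n∸m]≡n s≤n
  Y≡ : Y ≡ slice ω 0 (s + t)
  Y≡ = trans (sym (slice-omegaAt d Y)) (cong (slice ω 0) (sym s+t≡n))

primitive-rotation-trivial : {Y : List A} → Primitive Y → {s : ℕ} → s < length Y → drop s Y ++ take s Y ≡ Y → s ≡ 0
primitive-rotation-trivial {Y = Y} (_ , prim) {s} s<n rotY≡Y
  with comm⇒commonBase (take s Y) (drop s Y) (trans (take++drop≡id s Y) (sym rotY≡Y))
... | Z , a , b , take≡ , drop≡
  with prim Z (a + b) (trans (sym (take++drop≡id s Y)) (trans (cong₂ _++_ take≡ drop≡) (sym (powA-+ Z a b))))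
... | a+b≡1 with a
...   | zero = trans (sym (trans (length-take s Y) (m≤n⇒m⊓n≡m (<⇒≤ s<n)))) (cong length take≡)
...   | suc a′ = contradiction (trans (sym (length-drop s Y)) (cong length drop≡′)) (m>n⇒m∸n≢0 s<n)
  where
  drop≡′ : drop s Y ≡ []
  drop≡′ = trans drop≡ (cong (powA Z) (m+n≡0⇒n≡0 a′ (suc-injective a+b≡1)))

primitive-period : (d : A) {Y : List A} → Primitive Y → {s : ℕ} →
                   (∀ q → omegaAt d Y (s + q) ≡ omegaAt d Y q) → length Y ∣ s
primitive-period d {Y} prim {s} shift = m%n≡0⇒n∣m s n (primitive-rotation-trivial prim (m%n<n s n) rotY≡Y)
  where
  n = length Y
  instance
    _ : NonZero n
    _ = length-nonZero (proj₁ prim)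
  ω = omegaAt d Y
  shift% : ∀ q → ω (s % n + q) ≡ ω q
  shift% q = begin
    ω (s % n + q)                 ≡⟨ periodic-* (omegaAt-periodic d Y) (s / n) (s % n + q) ⟨
    ω (s / n * n + (s % n + q))   ≡⟨ cong ω (+-assoc (s / n * n) (s % n) q) ⟨
    ω (s / n * n + s % n + q)     ≡⟨ cong (λ m → ω (m + q)) (+-comm (s / n * n) (s % n)) ⟩
    ω (s % n + s / n * n + q)     ≡⟨ cong (λ m → ω (m + q)) (m≡m%n+[m/n]*n s n) ⟨
    ω (s + q)                     ≡⟨ shift q ⟩
    ω q                           ∎
    where open ≡-Reasoning
  rotY≡Y : drop (s % n) Y ++ take (s % n) Y ≡ Y
  rotY≡Y = begin
    drop (s % n) Y ++ take (s % n) Y  ≡⟨ rotation-slice d Y (<⇒≤ (m%n<n s n)) ⟩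
    slice ω (s % n) n                 ≡⟨ slice-shift ω (s % n) n ⟩
    slice (λ q → ω (s % n + q)) 0 n   ≡⟨ slice-cong shift% 0 n ⟩
    slice ω 0 n                       ≡⟨ slice-omegaAt d Y ⟩
    Y                                 ∎
    where open ≡-Reasoning

-- Previous-smaller distances of infinite words

≤ᵇ-true : {m n : ℕ} → m ≤ n → (m ≤ᵇ n) ≡ true
≤ᵇ-true m≤n = Equivalence.to T-≡ (≤⇒≤ᵇ m≤n)

≤ᵇ-false : {m n : ℕ} → n < m → (m ≤ᵇ n) ≡ false
≤ᵇ-false {m} {n} n<m with m ≤ᵇ n in eq
... | false = refl
... | true  = contradiction (≤ᵇ⇒≤ m n (Equivalence.from T-≡ eq)) (<⇒≱ n<m)

≤S-refl : (x : Sym) → x ≤S x ≡ true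
≤S-refl $       = refl
≤S-refl (chr a) = ≤ᵇ-true (≤-refl {a})

≤S-<S-trans : (c x y : Sym) → c ≤S x ≡ true → y ≤S x ≡ false → c ≤S y ≡ true
≤S-<S-trans c       x       $       _    ()
≤S-<S-trans $       x       (chr b) _    _    = refl
≤S-<S-trans (chr e) $       (chr b) ()   _
≤S-<S-trans (chr e) (chr a) (chr b) e≤a b≰ᵇa =
  ≤ᵇ-true (≤-trans (≤ᵇ⇒≤ e a (Equivalence.from T-≡ e≤a)) (<⇒≤ (≰⇒> b≰a)))
  where
  b≰a : ¬ b ≤ a
  b≰a b≤a = contradiction (trans (sym (≤ᵇ-true b≤a)) b≰ᵇa) λ ()

_orElse_ : PDSym → PDSym → PDSym
pd$   orElse b = pd$
num e orElse b = num e
pd∞   orElse b = b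

orElse-finite : {a : PDSym} (b : PDSym) → a ≢ pd∞ → a orElse b ≡ a
orElse-finite {pd$}   b _    = refl
orElse-finite {num e} b _    = refl
orElse-finite {pd∞}   b a≢∞ = contradiction refl a≢∞

lookBack-++ : (xs ys : List Sym) (c : Sym) (d : ℕ) →
              lookBack (xs ++ ys) c d ≡ lookBack xs c d orElse lookBack ys c (length xs + d)
lookBack-++ []       ys c d = refl
lookBack-++ (y ∷ xs) ys c d with y ≤S c
... | true  = refl
... | false = trans (lookBack-++ xs ys c (suc d)) (cong (λ n → lookBack xs c (suc d) orElse lookBack ys c n) (+-suc (length xs) d))

lookBack-≢$ : (xs : List Sym) (c : Sym) (d : ℕ) → lookBack xs c d ≢ pd$
lookBack-≢$ []       c d ()
lookBack-≢$ (y ∷ xs) c d with y ≤S c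
... | true  = λ ()
... | false = lookBack-≢$ xs c (suc d)

lookBack-range : (xs : List Sym) (c : Sym) (d : ℕ) {e : ℕ} → lookBack xs c d ≡ num e → d ≤ e × e < d + length xs
lookBack-range []       c d ()
lookBack-range (y ∷ xs) c d eq with y ≤S c
lookBack-range (y ∷ xs) c d refl | true  = ≤-refl , m<m+n d z<s
... | false with lookBack-range xs c (suc d) eq
... | d<e , e<end = <⇒≤ d<e , subst (_<_ _) (sym (+-suc d (length xs))) e<end

revPrefix : (ℕ → Sym) → ℕ → List Sym
revPrefix S zero    = []
revPrefix S (suc q) = S q ∷ revPrefix S q

length-revPrefix : (S : ℕ → Sym) (q : ℕ) → length (revPrefix S q) ≡ q
length-revPrefix S zero    = refl
length-revPrefix S (suc q) = cong suc (length-revPrefix S q)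

revPrefix-cong : {S S′ : ℕ → Sym} → S ≗ S′ → (q : ℕ) → revPrefix S q ≡ revPrefix S′ q
revPrefix-cong S≗S′ zero    = refl
revPrefix-cong S≗S′ (suc q) = cong₂ _∷_ (S≗S′ q) (revPrefix-cong S≗S′ q)

revPrefix-+ : (S : ℕ → Sym) (k m : ℕ) → revPrefix S (k + m) ≡ revPrefix (λ j → S (k + j)) m ++ revPrefix S k
revPrefix-+ S k zero    = cong (revPrefix S) (+-identityʳ k)
revPrefix-+ S k (suc m) = trans (cong (revPrefix S) (+-suc k m)) (cong (S (k + m) ∷_) (revPrefix-+ S k m))

lookBack-hit : (S : ℕ → Sym) (m : ℕ) (c : Sym) (d : ℕ) {j : ℕ} → j < m → S j ≤S c ≡ true →
               lookBack (revPrefix S m) c d ≢ pd∞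
lookBack-hit S (suc m) c d {j} j<m Sj≤c with S m ≤S c in Sm≤c
... | true  = λ ()
... | false with m≤n⇒m<n∨m≡n (≤-pred j<m)
...   | inj₁ j<m′ = lookBack-hit S m c (suc d) j<m′ Sj≤c
...   | inj₂ refl = contradiction (trans (sym Sj≤c) Sm≤c) λ ()

lookBack-∞ : (S : ℕ → Sym) (m : ℕ) (c : Sym) (d : ℕ) → lookBack (revPrefix S m) c d ≡ pd∞ →
             ∀ j → j < m → S j ≤S c ≡ false
lookBack-∞ S m c d ≡∞ j j<m with S j ≤S c in Sj≤c
... | false = refl
... | true  = contradiction ≡∞ (lookBack-hit S m c d j<m Sj≤c)

-- PD(S)[q + 1] for an infinite word S; positions in infinite words are 0-indexed throughout.
PDseq : (ℕ → Sym) → ℕ → PDSym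
PDseq S q = pdAt (revPrefix S q) (S q)

PDseq-cong : {S S′ : ℕ → Sym} → S ≗ S′ → PDseq S ≗ PDseq S′
PDseq-cong S≗S′ q = cong₂ pdAt (revPrefix-cong S≗S′ q) (S≗S′ q)

PD-slice : (S : ℕ → Sym) (m : ℕ) → PD (slice S 0 m) ≡ slice (PDseq S) 0 m
PD-slice S = go 0
  where
  go : ∀ k m → pdGo (revPrefix S k) (slice S k m) ≡ slice (PDseq S) k m
  go k zero    = refl
  go k (suc m) = cong (PDseq S k ∷_) (go (suc k) m)

PDseq-range : (S : ℕ → Sym) (q : ℕ) {e : ℕ} → PDseq S q ≡ num e → 1 ≤ e × e ≤ q
PDseq-range S q eq with S q
... | chr a with lookBack-range (revPrefix S q) (chr a) 1 eq
... | 1≤e , e<end = 1≤e , ≤-pred (subst (_<_ _) (cong suc (length-revPrefix S q)) e<end)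

PDseq-∞ : (S : ℕ → Sym) (q : ℕ) → PDseq S q ≡ pd∞ → ∀ j → j < q → S j ≤S S q ≡ false
PDseq-∞ S q eq with S q
... | chr a = lookBack-∞ S q (chr a) 1 eq

PDseq-hit : (S : ℕ → Sym) {q j : ℕ} → j < q → S j ≤S S q ≡ true → PDseq S q ≢ pd∞
PDseq-hit S {q} j<q Sj≤Sq with S q
... | $     = λ ()
... | chr a = lookBack-hit S q (chr a) 1 j<q Sj≤Sq

PDseq-window : (S : ℕ → Sym) (k : ℕ) {q j : ℕ} → j < q → S (k + j) ≤S S (k + q) ≡ true →
               PDseq (λ i → S (k + i)) q ≡ PDseq S (k + q)
PDseq-window S k {q} j<q hit with S (k + q)
... | $     = refl
... | chr a = sym (begin
  lookBack (revPrefix S (k + q)) (chr a) 1                          ≡⟨ cong (λ xs → lookBack xs (chr a) 1) (revPrefix-+ S k q) ⟩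
  lookBack (revPrefix S′ q ++ revPrefix S k) (chr a) 1              ≡⟨ lookBack-++ (revPrefix S′ q) (revPrefix S k) (chr a) 1 ⟩
  lookBack (revPrefix S′ q) (chr a) 1 orElse _                     ≡⟨ orElse-finite _ (lookBack-hit S′ q (chr a) 1 j<q hit) ⟩
  lookBack (revPrefix S′ q) (chr a) 1                              ∎)
  where
  S′ = λ i → S (k + i)
  open ≡-Reasoning

Beyond : ℕ → PDSym → Set
Beyond q b = b ≡ pd∞ ⊎ ∃ λ e → b ≡ num e × q < e

-- In an N-periodic word, looking back from N + q first scans the q symbols of the current period.
PDseq-periodic : (S : ℕ → Sym) (N : ℕ) → Periodic N S → ∀ q →
                 ∃ λ b → PDseq S (N + q) ≡ PDseq S q orElse b × Beyond q b
PDseq-periodic S N per q rewrite per q with S q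
... | $     = pd∞ , refl , inj₁ refl
... | chr a = b , lookBack-split , beyond
  where
  b = lookBack (revPrefix S N) (chr a) (suc q)
  revPrefix-N+q : revPrefix S (N + q) ≡ revPrefix S q ++ revPrefix S N
  revPrefix-N+q = trans (revPrefix-+ S N q) (cong (_++ revPrefix S N) (revPrefix-cong per q))
  lookBack-split : lookBack (revPrefix S (N + q)) (chr a) 1 ≡ lookBack (revPrefix S q) (chr a) 1 orElse b
  lookBack-split = trans (cong (λ xs → lookBack xs (chr a) 1) revPrefix-N+q)
    (trans (lookBack-++ (revPrefix S q) (revPrefix S N) (chr a) 1)
           (cong (λ n → lookBack (revPrefix S q) (chr a) 1 orElse lookBack (revPrefix S N) (chr a) n)
                 (trans (cong (_+ 1) (length-revPrefix S q)) (+-comm q 1))))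
  beyond : Beyond q b
  beyond with b in eq
  ... | pd∞   = inj₁ refl
  ... | pd$   = contradiction eq (lookBack-≢$ (revPrefix S N) (chr a) (suc q))
  ... | num e = inj₂ (e , refl , proj₁ (lookBack-range (revPrefix S N) (chr a) (suc q) eq))

-- Previous-smaller distances of V^ω and RPD(V)^ω, and rotations

_^ω : List Sym → ℕ → Sym
V ^ω = omegaAt $ V

PDω : List Sym → ℕ → PDSym
PDω V = PDseq (V ^ω)

RPDω : List Sym → ℕ → PDSym
RPDω V = omegaAt pd$ (RPD V)

^ω-periodic : (V : List Sym) → Periodic (length V) (V ^ω)
^ω-periodic = omegaAt-periodic $

PD-omegaPrefix : (V : List Sym) → V ≢ [] → (i : ℕ) → PD (omegaPrefix V i) ≡ slice (PDω V) 0 i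
PD-omegaPrefix V V≢[] i = begin
  PD (take i (powA V (suc i)))                          ≡⟨ cong (λ X → PD (take i X)) (powA-slice $ V (suc i)) ⟩
  PD (take i (slice (V ^ω) 0 (suc i * length V)))       ≡⟨ cong PD (take-slice (V ^ω) 0 i≤) ⟩
  PD (slice (V ^ω) 0 i)                                 ≡⟨ PD-slice (V ^ω) i ⟩
  slice (PDω V) 0 i                                     ∎
  where
  open ≡-Reasoning
  i≤ : i ≤ suc i * length V
  i≤ = ≤-trans (n≤1+n i) (m≤m*n (suc i) (length V) {{length-nonZero V≢[]}})

RPD-slice : (V : List Sym) → RPD V ≡ slice (PDω V) (length V) (length V)
RPD-slice V = begin
  drop (length V) (PD (V ++ V))                                       ≡⟨ cong (λ X → drop (length V) (PD X)) (++-slice $ V V (λ _ → refl)) ⟩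
  drop (length V) (PD (slice (V ^ω) 0 (length V + length V)))       ≡⟨ cong (drop (length V)) (PD-slice (V ^ω) _) ⟩
  drop (length V) (slice (PDω V) 0 (length V + length V))           ≡⟨ drop-slice (PDω V) 0 (length V) (length V) ⟩
  slice (PDω V) (length V) (length V)                               ∎
  where open ≡-Reasoning

length-RPD : (V : List Sym) → length (RPD V) ≡ length V
length-RPD V = trans (cong length (RPD-slice V)) (length-slice _ _ _)

RPD-≢[] : {V : List Sym} → V ≢ [] → RPD V ≢ []
RPD-≢[] {[]}        V≢[] _       = V≢[] refl
RPD-≢[] {V@(_ ∷ _)} _    RPD≡[] = 0≢1+n (trans (sym (cong length RPD≡[])) (length-RPD V))

PDω-finite : {V : List Sym} → V ≢ [] → {q : ℕ} → length V ≤ q → PDω V q ≢ pd∞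
PDω-finite {V} V≢[] {q} N≤q = PDseq-hit (V ^ω) (∸-monoʳ-< {q} {length V} {0} (>-nonZero⁻¹ _ {{length-nonZero V≢[]}}) N≤q)
  (subst (λ x → (V ^ω) (q ∸ length V) ≤S x ≡ true) same-symbol (≤S-refl ((V ^ω) (q ∸ length V))))
  where
  same-symbol : (V ^ω) (q ∸ length V) ≡ (V ^ω) q
  same-symbol = trans (sym (^ω-periodic V (q ∸ length V))) (cong (V ^ω) (m+[n∸m]≡n N≤q))

PDω-shift : (V : List Sym) (q : ℕ) → PDω V q ≢ pd∞ → PDω V (length V + q) ≡ PDω V q
PDω-shift V q finite with PDseq-periodic (V ^ω) (length V) (^ω-periodic V) q
... | b , eq , _ = trans eq (orElse-finite b finite)

RPDω-periodic : (V : List Sym) → Periodic (length V) (RPDω V)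
RPDω-periodic V q = trans (cong (λ n → RPDω V (n + q)) (sym (length-RPD V))) (omegaAt-periodic pd$ (RPD V) q)

PDω-RPDω : {V : List Sym} → V ≢ [] → ∀ q → PDω V (length V + q) ≡ RPDω V q
PDω-RPDω {V} V≢[] = periodic-≗ {{length-nonZero V≢[]}} per (RPDω-periodic V) agree
  where
  N = length V
  per : Periodic N (λ q → PDω V (N + q))
  per q = PDω-shift V (N + q) (PDω-finite V≢[] (m≤m+n N q))
  agree : ∀ q → q < N → PDω V (N + q) ≡ RPDω V q
  agree q q<N = sym (begin
    omegaAt pd$ (RPD V) q          ≡⟨ omegaAt-< pd$ (RPD V) (subst (q <_) (sym (length-RPD V)) q<N) ⟩
    at pd$ (RPD V) q               ≡⟨ cong (λ X → at pd$ X q) (RPD-slice V) ⟩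
    at pd$ (slice (PDω V) N N) q   ≡⟨ at-slice pd$ (PDω V) N q<N ⟩
    PDω V (N + q)                  ∎)
    where open ≡-Reasoning

PDω-RPDω-≥ : {V : List Sym} → V ≢ [] → {q : ℕ} → length V ≤ q → PDω V q ≡ RPDω V q
PDω-RPDω-≥ {V} V≢[] {q} N≤q = begin
  PDω V q                        ≡⟨ cong (PDω V) (m+[n∸m]≡n N≤q) ⟨
  PDω V (length V + (q ∸ length V))  ≡⟨ PDω-RPDω V≢[] (q ∸ length V) ⟩
  RPDω V (q ∸ length V)          ≡⟨ RPDω-periodic V (q ∸ length V) ⟨
  RPDω V (length V + (q ∸ length V)) ≡⟨ cong (RPDω V) (m+[n∸m]≡n N≤q) ⟩
  RPDω V q                       ∎
  where open ≡-Reasoning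

-- At position q of V^ω a distance larger than q would point before the start of the word.
cap : ℕ → PDSym → PDSym
cap q pd$     = pd$
cap q (num e) = if e ≤ᵇ q then num e else pd∞
cap q pd∞     = pd∞

cap-orElse : {q : ℕ} (a b : PDSym) → (∀ {e} → a ≡ num e → e ≤ q) → Beyond q b → cap q (a orElse b) ≡ a
cap-orElse pd$     b _   _                          = refl
cap-orElse (num e) b e≤q _                          = cong (if_then num e else pd∞) (≤ᵇ-true (e≤q refl))
cap-orElse pd∞     b _   (inj₁ refl)                = refl
cap-orElse pd∞     b _   (inj₂ (e , refl , q<e))    = cong (if_then num e else pd∞) (≤ᵇ-false q<e)

PDω-cap : {V : List Sym} → V ≢ [] → ∀ q → PDω V q ≡ cap q (RPDω V q)
PDω-cap {V} V≢[] q with PDseq-periodic (V ^ω) (length V) (^ω-periodic V) q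
... | b , eq , beyond = sym (begin
  cap q (RPDω V q)                ≡⟨ cong (cap q) (PDω-RPDω V≢[] q) ⟨
  cap q (PDω V (length V + q))    ≡⟨ cong (cap q) eq ⟩
  cap q (PDω V q orElse b)        ≡⟨ cap-orElse (PDω V q) b (λ eq′ → proj₂ (PDseq-range (V ^ω) q eq′)) beyond ⟩
  PDω V q                         ∎)
  where open ≡-Reasoning

root-of-power : {R Z X : List A} → IsRoot R Z → (a : ℕ) → X ≡ powA Z a → IsRoot R X
root-of-power {R = R} (prim , c , Z≡) a X≡ = prim , a * c , trans X≡ (trans (cong (λ Y → powA Y a) Z≡) (powA-* R c a))

SameRoot⇒RPDω-≗ : {V U : List Sym} → V ≢ [] → U ≢ [] → SameRoot (RPD V) (RPD U) → RPDω V ≗ RPDω U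
SameRoot⇒RPDω-≗ V≢[] U≢[] (Y , (_ , k , V≡) , (_ , k′ , U≡)) q =
  trans (omegaAt-powA pd$ Y k V≡ (RPD-≢[] V≢[]) q) (sym (omegaAt-powA pd$ Y k′ U≡ (RPD-≢[] U≢[]) q))

RPDω-≗⇒¬¬SameRoot : {V U : List Sym} → V ≢ [] → U ≢ [] → RPDω V ≗ RPDω U → DoubleNegation (SameRoot (RPD V) (RPD U))
RPDω-≗⇒¬¬SameRoot {V} {U} V≢[] _ V≗U with comm⇒commonBase (RPD V) (RPD U) (omegaAt-≗⇒comm pd$ (RPD V) (RPD U) V≗U)
... | Z , a , b , V≡ , U≡ = do
  (R , R-root) ← ¬¬-root Z Z≢[]
  pure (R , root-of-power R-root a V≡ , root-of-power R-root b U≡)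
  where
  Z≢[] : Z ≢ []
  Z≢[] refl = RPD-≢[] V≢[] (trans V≡ (powA-[] a))

RPDω-≗⇒PDω-≗ : {V U : List Sym} → V ≢ [] → U ≢ [] → RPDω V ≗ RPDω U → PDω V ≗ PDω U
RPDω-≗⇒PDω-≗ V≢[] U≢[] V≗U q = trans (PDω-cap V≢[] q) (trans (cong (cap q) (V≗U q)) (sym (PDω-cap U≢[] q)))

PDω-≗⇒RPDω-≗ : {V U : List Sym} → V ≢ [] → U ≢ [] → PDω V ≗ PDω U → RPDω V ≗ RPDω U
PDω-≗⇒RPDω-≗ {V} {U} V≢[] U≢[] V≗U q = begin
  RPDω V q                            ≡⟨ periodic-* (RPDω-periodic V) (length U) q ⟨
  RPDω V (length U * length V + q)    ≡⟨ PDω-RPDω-≥ V≢[] (≤-trans (m≤n*m (length V) (length U) {{length-nonZero U≢[]}}) (m≤m+n _ q)) ⟨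
  PDω V (length U * length V + q)     ≡⟨ V≗U _ ⟩
  PDω U (length U * length V + q)     ≡⟨ PDω-RPDω-≥ U≢[] (≤-trans (m≤m*n (length U) (length V) {{length-nonZero V≢[]}}) (m≤m+n _ q)) ⟩
  RPDω U (length U * length V + q)    ≡⟨ cong (λ n → RPDω U (n + q)) (*-comm (length U) (length V)) ⟩
  RPDω U (length V * length U + q)    ≡⟨ periodic-* (RPDω-periodic U) (length V) q ⟩
  RPDω U q                            ∎
  where open ≡-Reasoning

length-rot1 : (V : List Sym) → length (rot1 V) ≡ length V
length-rot1 []      = refl
length-rot1 (c ∷ Z) = trans (length-++ Z) (+-comm (length Z) 1)

length-rot : (k : ℕ) (V : List Sym) → length (rot k V) ≡ length V
length-rot zero    V = refl
length-rot (suc k) V = trans (length-rot1 (rot k V)) (length-rot k V)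

length-≡-≢[] : {V U : List Sym} → length V ≡ length U → U ≢ [] → V ≢ []
length-≡-≢[] eq U≢[] refl = U≢[] (length-0⇒[] (sym eq))
  where
  length-0⇒[] : {U : List Sym} → length U ≡ 0 → U ≡ []
  length-0⇒[] {[]} _ = refl

rot-≢[] : (k : ℕ) {V : List Sym} → V ≢ [] → rot k V ≢ []
rot-≢[] k {V} = length-≡-≢[] (length-rot k V)

^ω-rot1 : (c : Sym) (Z : List Sym) → rot1 (c ∷ Z) ^ω ≗ (λ q → ((c ∷ Z) ^ω) (suc q))
^ω-rot1 c Z = periodic-≗ per-rot per-shift agree
  where
  V = c ∷ Z
  per-rot : Periodic (length V) (rot1 V ^ω)
  per-rot q = trans (cong (λ n → (rot1 V ^ω) (n + q)) (sym (length-rot1 V))) (^ω-periodic (rot1 V) q)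
  per-shift : Periodic (length V) (λ q → (V ^ω) (suc q))
  per-shift q = trans (cong (V ^ω) (sym (+-suc (length V) q))) (^ω-periodic V (suc q))
  agree : ∀ q → q < length V → (rot1 V ^ω) q ≡ (V ^ω) (suc q)
  agree q (s≤s q≤n) with m≤n⇒m<n∨m≡n q≤n
  ... | inj₁ q<n = begin
    (rot1 V ^ω) q        ≡⟨ omegaAt-< $ (Z ++ [ c ]) (subst (q <_) (sym (length-rot1 V)) (s≤s q≤n)) ⟩
    at $ (Z ++ [ c ]) q  ≡⟨ at-++ˡ $ Z [ c ] q<n ⟩
    at $ V (suc q)       ≡⟨ omegaAt-< $ V (s≤s q<n) ⟨
    (V ^ω) (suc q)       ∎
    where open ≡-Reasoning
  ... | inj₂ refl = begin
    (rot1 V ^ω) (length Z)          ≡⟨ omegaAt-< $ (Z ++ [ c ]) (subst (length Z <_) (sym (length-rot1 V)) ≤-refl) ⟩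
    at $ (Z ++ [ c ]) (length Z)    ≡⟨ cong (at $ (Z ++ [ c ])) (+-identityʳ (length Z)) ⟨
    at $ (Z ++ [ c ]) (length Z + 0) ≡⟨ at-++ʳ $ Z [ c ] 0 ⟩
    c                               ≡⟨ ^ω-periodic V 0 ⟨
    (V ^ω) (length V + 0)           ≡⟨ cong (V ^ω) (+-identityʳ (length V)) ⟩
    (V ^ω) (suc (length Z))         ∎
    where open ≡-Reasoning

^ω-rot : (k : ℕ) {V : List Sym} → V ≢ [] → rot k V ^ω ≗ (λ q → (V ^ω) (k + q))
^ω-rot zero    V≢[] q = refl
^ω-rot (suc k) {V} V≢[] q with rot k V in rotV | rot-≢[] k V≢[]
... | []    | rot≢[] = contradiction refl rot≢[]
... | c ∷ Z | _      = begin
  (rot1 (c ∷ Z) ^ω) q        ≡⟨ ^ω-rot1 c Z q ⟩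
  ((c ∷ Z) ^ω) (suc q)       ≡⟨ cong (λ X → (X ^ω) (suc q)) rotV ⟨
  (rot k V ^ω) (suc q)       ≡⟨ ^ω-rot k V≢[] (suc q) ⟩
  (V ^ω) (k + suc q)         ≡⟨ cong (V ^ω) (+-suc k q) ⟩
  (V ^ω) (suc k + q)         ∎
  where open ≡-Reasoning

-- The lookback from k + N + q in V^ω stops at the copy k + q of its own symbol, so it never leaves (rot k V)^ω.
RPDω-rot : (k : ℕ) {V : List Sym} → V ≢ [] → ∀ q → RPDω (rot k V) q ≡ RPDω V (k + q)
RPDω-rot k {V} V≢[] q = begin
  RPDω (rot k V) q                          ≡⟨ PDω-RPDω (rot-≢[] k V≢[]) q ⟨
  PDω (rot k V) (length (rot k V) + q)      ≡⟨ cong (λ n → PDω (rot k V) (n + q)) (length-rot k V) ⟩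
  PDω (rot k V) (N + q)                     ≡⟨ PDseq-cong (^ω-rot k V≢[]) (N + q) ⟩
  PDseq (λ i → (V ^ω) (k + i)) (N + q)      ≡⟨ PDseq-window (V ^ω) k (m<n+m q (>-nonZero⁻¹ N {{length-nonZero V≢[]}})) hit ⟩
  PDω V (k + (N + q))                       ≡⟨ PDω-RPDω-≥ V≢[] (≤-trans (m≤m+n N q) (m≤n+m (N + q) k)) ⟩
  RPDω V (k + (N + q))                      ≡⟨ cong (RPDω V) k+N+q≡ ⟩
  RPDω V (N + (k + q))                      ≡⟨ RPDω-periodic V (k + q) ⟩
  RPDω V (k + q)                            ∎
  where
  open ≡-Reasoning
  N = length V
  k+N+q≡ : k + (N + q) ≡ N + (k + q)
  k+N+q≡ = trans (sym (+-assoc k N q)) (trans (cong (_+ q) (+-comm k N)) (+-assoc N k q))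
  hit : (V ^ω) (k + q) ≤S (V ^ω) (k + (N + q)) ≡ true
  hit = subst (λ x → (V ^ω) (k + q) ≤S x ≡ true)
              (sym (trans (cong (V ^ω) k+N+q≡) (^ω-periodic V (k + q)))) (≤S-refl ((V ^ω) (k + q)))

-- Prepending c to a word W: an ∞ at position q of PD(W^ω) becomes the distance q + 1 exactly when c ≤ W[q].
turn : Sym → Sym → ℕ → PDSym → PDSym
turn c x q a = a orElse (if c ≤S x then num (suc q) else pd∞)

pdAt-snoc : (xs : List Sym) (c x : Sym) → pdAt (xs ++ [ c ]) x ≡ turn c x (length xs) (pdAt xs x)
pdAt-snoc xs c $       = refl
pdAt-snoc xs c (chr a) = trans (lookBack-++ xs [ c ] (chr a) 1) (cong (lookBack xs (chr a) 1 orElse_) last)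
  where
  last : lookBack [ c ] (chr a) (length xs + 1) ≡ (if c ≤S chr a then num (suc (length xs)) else pd∞)
  last with c ≤S chr a
  ... | true  = cong num (+-comm (length xs) 1)
  ... | false = refl

PDω-suc : (c : Sym) (Z : List Sym) (q : ℕ) →
          PDω (c ∷ Z) (suc q) ≡ turn c ((rot1 (c ∷ Z) ^ω) q) q (PDω (rot1 (c ∷ Z)) q)
PDω-suc c Z q = begin
  pdAt (revPrefix (V ^ω) (suc q)) ((V ^ω) (suc q))      ≡⟨ cong₂ pdAt revPrefix-suc (sym (^ω-rot1 c Z q)) ⟩
  pdAt (revPrefix (W ^ω) q ++ [ c ]) ((W ^ω) q)         ≡⟨ pdAt-snoc (revPrefix (W ^ω) q) c ((W ^ω) q) ⟩
  turn c ((W ^ω) q) (length (revPrefix (W ^ω) q)) (PDω W q)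
    ≡⟨ cong (λ n → turn c ((W ^ω) q) n (PDω W q)) (length-revPrefix (W ^ω) q) ⟩
  turn c ((W ^ω) q) q (PDω W q)                          ∎
  where
  open ≡-Reasoning
  V = c ∷ Z
  W = rot1 V
  revPrefix-suc : revPrefix (V ^ω) (suc q) ≡ revPrefix (W ^ω) q ++ [ c ]
  revPrefix-suc = trans (revPrefix-+ (V ^ω) 1 q) (cong (_++ [ c ]) (revPrefix-cong (λ j → sym (^ω-rot1 c Z j)) q))

-- Counting

boolToℕ : Bool → ℕ
boolToℕ true  = 1
boolToℕ false = 0

count : (ℕ → Bool) → ℕ → ℕ → ℕ
count f k zero    = 0
count f k (suc m) = boolToℕ (f k) + count f (suc k) m

count-++ : (f : ℕ → Bool) (k m n : ℕ) → count f k (m + n) ≡ count f k m + count f (k + m) n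
count-++ f k zero    n = cong (λ i → count f i n) (sym (+-identityʳ k))
count-++ f k (suc m) n = trans (cong (boolToℕ (f k) +_) (trans (count-++ f (suc k) m n)
                                 (cong (λ i → count f (suc k) m + count f i n) (sym (+-suc k m)))))
                               (sym (+-assoc (boolToℕ (f k)) _ _))

count-shift : (f : ℕ → Bool) (k m : ℕ) → count f (suc k) m ≡ count (λ q → f (suc q)) k m
count-shift f k zero    = refl
count-shift f k (suc m) = cong (boolToℕ (f (suc k)) +_) (count-shift f (suc k) m)

count-≤ : (f : ℕ → Bool) (k : ℕ) {m n : ℕ} → m ≤ n → count f k m ≤ count f k n
count-≤ f k {m} {n} m≤n =
  subst (count f k m ≤_) (trans (sym (count-++ f k m (n ∸ m))) (cong (count f k) (m+[n∸m]≡n m≤n))) (m≤m+n _ _)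

count-suc : (f : ℕ → Bool) (m : ℕ) → count f 0 (suc m) ≡ boolToℕ (f m) + count f 0 m
count-suc f m = begin
  count f 0 (suc m)                          ≡⟨ cong (count f 0) (+-comm 1 m) ⟩
  count f 0 (m + 1)                          ≡⟨ count-++ f 0 m 1 ⟩
  count f 0 m + (boolToℕ (f m) + 0)          ≡⟨ +-comm (count f 0 m) _ ⟩
  (boolToℕ (f m) + 0) + count f 0 m          ≡⟨ cong (_+ count f 0 m) (+-identityʳ _) ⟩
  boolToℕ (f m) + count f 0 m                ∎
  where open ≡-Reasoning

count-mono : (f g : ℕ → Bool) (k m : ℕ) → (∀ q → q < k + m → f q ≡ true → g q ≡ true) → count f k m ≤ count g k m
count-mono f g k zero    f⇒g = z≤n
count-mono f g k (suc m) f⇒g =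
  +-mono-≤ (head-bit (f k) refl) (count-mono f g (suc k) m (λ q lt → f⇒g q (subst (q <_) (sym (+-suc k m)) lt)))
  where
  head-bit : ∀ b → f k ≡ b → boolToℕ b ≤ boolToℕ (g k)
  head-bit false _  = z≤n
  head-bit true  fk = ≤-reflexive (cong boolToℕ (sym (f⇒g k (m<m+n k z<s) fk)))

count-cong : (f g : ℕ → Bool) (k m : ℕ) → (∀ q → q < k + m → f q ≡ g q) → count f k m ≡ count g k m
count-cong f g k m f≡g = ≤-antisym (count-mono f g k m (λ q lt eq → trans (sym (f≡g q lt)) eq))
                                   (count-mono g f k m (λ q lt eq → trans (f≡g q lt) eq))

count-zero : (f : ℕ → Bool) (k m : ℕ) → (∀ q → k ≤ q → f q ≡ false) → count f k m ≡ 0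
count-zero f k zero    _   = refl
count-zero f k (suc m) off = cong₂ _+_ (cong boolToℕ (off k ≤-refl)) (count-zero f (suc k) m (λ q lt → off q (<⇒≤ lt)))

count-sum : (f g h : ℕ → Bool) (k m : ℕ) → (∀ q → boolToℕ (f q) ≡ boolToℕ (g q) + boolToℕ (h q)) →
            count f k m ≡ count g k m + count h k m
count-sum f g h k zero    split = refl
count-sum f g h k (suc m) split =
  trans (cong₂ _+_ (split k) (count-sum f g h (suc k) m split))
        (+-interchange (boolToℕ (g k)) (boolToℕ (h k)) (count g (suc k) m) (count h (suc k) m))

remove-∈ : {z x : A} (us vs : List A) → z ∈ us ++ x ∷ vs → z ≢ x → z ∈ us ++ vs
remove-∈ []       vs (here z≡x)  z≢x = contradiction z≡x z≢x
remove-∈ []       vs (there z∈)  _   = z∈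
remove-∈ (u ∷ us) vs (here z≡u)  _   = here z≡u
remove-∈ (u ∷ us) vs (there z∈)  z≢x = there (remove-∈ us vs z∈ z≢x)

unique-⊆⇒length-≤ : (xs ys : List A) → Unique xs → (∀ {z} → z ∈ xs → z ∈ ys) → length xs ≤ length ys
unique-⊆⇒length-≤ []       ys _              _  = z≤n
unique-⊆⇒length-≤ (x ∷ xs) ys (x∉xs ∷ uniq) xs⊆ys with ∈-∃++ (xs⊆ys (here refl))
... | us , vs , refl = subst (suc (length xs) ≤_) (sym length-ys) (s≤s (unique-⊆⇒length-≤ xs (us ++ vs) uniq xs⊆us++vs))
  where
  xs⊆us++vs : ∀ {z} → z ∈ xs → z ∈ us ++ vs
  xs⊆us++vs z∈xs = remove-∈ us vs (xs⊆ys (there z∈xs)) (λ z≡x → All.lookup x∉xs z∈xs (sym z≡x))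
  length-ys : length (us ++ x ∷ vs) ≡ suc (length (us ++ vs))
  length-ys = trans (length-++ us) (trans (+-suc (length us) (length vs)) (cong suc (sym (length-++ us))))

-- Membership in a list of naturals is decidable, so doubly negated inclusions suffice.
count-< : {n m m′ : ℕ} {P Q : ℕ → Set} → CountIs n P m → CountIs n Q m′ →
          (∀ z → InRange n z → P z → DoubleNegation (Q z)) →
          {w : ℕ} → InRange n w → DoubleNegation (Q w) → ¬ P w → m < m′
count-< {n} {P = P} {Q} (ks , uniq , mem , refl) (ks′ , _ , mem′ , refl) P⇒Q {w} rw Qw ¬Pw =
  unique-⊆⇒length-≤ (w ∷ ks) ks′ (All.tabulate w≢ ∷ uniq) included
  where
  w≢ : ∀ {z} → z ∈ ks → w ≢ z
  w≢ z∈ks refl = ¬Pw (proj₂ (Equivalence.to (mem w) z∈ks))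
  ¬¬∈ks′ : ∀ {z} → z ∈ w ∷ ks → DoubleNegation (z ∈ ks′)
  ¬¬∈ks′ (here refl) = do
    Qz ← Qw
    pure (Equivalence.from (mem′ w) (rw , Qz))
  ¬¬∈ks′ {z} (there z∈ks) = do
    let (rz , Pz) = Equivalence.to (mem z) z∈ks
    Qz ← P⇒Q z rz Pz
    pure (Equivalence.from (mem′ z) (rz , Qz))
  included : ∀ {z} → z ∈ w ∷ ks → z ∈ ks′
  included {z} z∈ = decidable-stable (z ∈? ks′) (¬¬∈ks′ z∈)

isInf : PDSym → Bool
isInf pd$     = false
isInf (num _) = false
isInf pd∞     = true

rank∞-slice : (f : ℕ → PDSym) (k m : ℕ) → rank∞ (slice f k m) m ≡ count (λ q → isInf (f q)) k m
rank∞-slice f k zero    = refl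
rank∞-slice f k (suc m) with f k
... | pd$   = rank∞-slice f (suc k) m
... | num _ = rank∞-slice f (suc k) m
... | pd∞   = cong suc (rank∞-slice f (suc k) m)

-- π(c ∷ Z) as the number of turned positions of rot1 (c ∷ Z)

turned : Sym → List Sym → ℕ → Bool
turned c W q = isInf (PDω W q) ∧ (c ≤S (W ^ω) q)

turned-∞ : (c : Sym) (W : List Sym) {q : ℕ} → turned c W q ≡ true → PDω W q ≡ pd∞
turned-∞ c W {q} eq with PDω W q
... | pd∞ = refl

turned-∞-isInf : (c : Sym) (W : List Sym) {q : ℕ} → turned c W q ≡ true → isInf (PDω W q) ≡ true
turned-∞-isInf c W eq = cong isInf (turned-∞ c W eq)

turned-≤S : (c : Sym) (W : List Sym) {q : ℕ} → turned c W q ≡ true → c ≤S (W ^ω) q ≡ true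
turned-≤S c W {q} eq with PDω W q
... | pd∞ = eq

-- The ∞ positions of PD(W^ω) are the strict prefix minima of W^ω, so c ≤ W[q] propagates to all earlier ones.
turned-downward : (c : Sym) (W : List Sym) {p q : ℕ} → p < q → PDω W p ≡ pd∞ → turned c W q ≡ true → turned c W p ≡ true
turned-downward c W {p} {q} p<q p∞ q-turned = begin
  isInf (PDω W p) ∧ (c ≤S (W ^ω) p)   ≡⟨ cong (λ a → isInf a ∧ (c ≤S (W ^ω) p)) p∞ ⟩
  c ≤S (W ^ω) p                       ≡⟨ ≤S-<S-trans c ((W ^ω) q) ((W ^ω) p) (turned-≤S c W q-turned)
                                           (PDseq-∞ (W ^ω) q (turned-∞ c W q-turned) p p<q) ⟩
  true                                ∎
  where open ≡-Reasoning

<ᵇ-true : {m n : ℕ} → m < n → (m <ᵇ n) ≡ true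
<ᵇ-true m<n = Equivalence.to T-≡ (<⇒<ᵇ m<n)

<ᵇ-false : {m n : ℕ} → n ≤ m → (m <ᵇ n) ≡ false
<ᵇ-false {m} {n} n≤m with m <ᵇ n in eq
... | false = refl
... | true  = contradiction (<ᵇ⇒< m n (Equivalence.from T-≡ eq)) (≤⇒≯ n≤m)

-- The turned positions are the first k of the ∞ positions, k being their number.
turned-char : (c : Sym) {W : List Sym} → W ≢ [] → {p : ℕ} → PDω W p ≡ pd∞ →
              c ≤S (W ^ω) p ≡ (count (λ q → isInf (PDω W q)) 0 p <ᵇ count (turned c W) 0 (length W))
turned-char c {W} W≢[] {p} p∞ with c ≤S (W ^ω) p in c≤Wp
... | true  = sym (<ᵇ-true (<-≤-trans infinities<turned (count-≤ (turned c W) 0 p<N)))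
  where
  p<N : p < length W
  p<N = ≰⇒> λ N≤p → PDω-finite W≢[] N≤p p∞
  p-turned : turned c W p ≡ true
  p-turned = trans (cong (λ a → isInf a ∧ (c ≤S (W ^ω) p)) p∞) c≤Wp
  infinities<turned : count (λ q → isInf (PDω W q)) 0 p < count (turned c W) 0 (suc p)
  infinities<turned =
    subst (count (λ q → isInf (PDω W q)) 0 p <_)
          (sym (trans (count-suc (turned c W) p) (cong (λ b → boolToℕ b + count (turned c W) 0 p) p-turned)))
          (s≤s (count-mono _ _ 0 p (λ q q<p q∞ → turned-downward c W q<p (isInf-∞ q∞) p-turned)))
    where
    isInf-∞ : {a : PDSym} → isInf a ≡ true → a ≡ pd∞
    isInf-∞ {pd∞} _ = refl
... | false = sym (<ᵇ-false (≤-trans turned-before (count-mono (turned c W) (λ q → isInf (PDω W q)) 0 p (λ q _ → turned-∞-isInf c W))))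
  where
  p-not-turned : turned c W p ≡ false
  p-not-turned = trans (cong (λ a → isInf a ∧ (c ≤S (W ^ω) p)) p∞) c≤Wp
  not-after : ∀ q → p ≤ q → turned c W q ≡ false
  not-after q p≤q with turned c W q in q-turned | m≤n⇒m<n∨m≡n p≤q
  ... | false | _         = refl
  ... | true  | inj₁ p<q  = contradiction (trans (sym (turned-downward c W p<q p∞ q-turned)) p-not-turned) λ ()
  ... | true  | inj₂ refl = contradiction (trans (sym q-turned) p-not-turned) λ ()
  turned-before : count (turned c W) 0 (length W) ≤ count (turned c W) 0 p
  turned-before with p ≤? length W
  ... | yes p≤N = ≤-reflexive (begin
    count (turned c W) 0 (length W)                                 ≡⟨ cong (count (turned c W) 0) (m+[n∸m]≡n p≤N) ⟨
    count (turned c W) 0 (p + (length W ∸ p))                       ≡⟨ count-++ (turned c W) 0 p (length W ∸ p) ⟩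
    count (turned c W) 0 p + count (turned c W) p (length W ∸ p)
      ≡⟨ cong (count (turned c W) 0 p +_) (count-zero (turned c W) p (length W ∸ p) not-after) ⟩
    count (turned c W) 0 p + 0                                      ≡⟨ +-identityʳ _ ⟩
    count (turned c W) 0 p                                          ∎)
    where open ≡-Reasoning
  ... | no p≰N = count-≤ (turned c W) 0 (<⇒≤ (≰⇒> p≰N))

isInf-turn : (c x : Sym) (q : ℕ) (a : PDSym) →
             boolToℕ (isInf a) ≡ boolToℕ (isInf (turn c x q a)) + boolToℕ (isInf a ∧ (c ≤S x))
isInf-turn c x q pd$     = refl
isInf-turn c x q (num _) = refl
isInf-turn c x q pd∞ with c ≤S x
... | true  = refl
... | false = refl

+[m+n]-+m : (m n : ℕ) → ℤ.+ (m + n) ℤ.- ℤ.+ m ≡ ℤ.+ n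
+[m+n]-+m m n = trans (ℤₚ.[+m]-[+n]≡m⊖n (m + n) m) (trans (ℤₚ.⊖-≥ (m≤m+n m n)) (cong ℤ.+_ (m+n∸m≡n m n)))

π-turned : (a : ℕ) (Z : List Sym) →
           π (chr a ∷ Z) ≡ val (ℤ.+ count (turned (chr a) (rot1 (chr a ∷ Z))) 0 (suc (length Z)))
π-turned a Z = cong val (begin
  ℤ.+ rank∞ (PD W) N ℤ.- ℤ.+ rank∞ (drop 1 (PD (chr a ∷ W))) N
    ≡⟨ cong₂ (λ X Y → ℤ.+ rank∞ X N ℤ.- ℤ.+ rank∞ Y N) PD-W PD-aW ⟩
  ℤ.+ rank∞ (slice (PDω W) 0 N) N ℤ.- ℤ.+ rank∞ (slice (PDω V) 1 N) N
    ≡⟨ cong₂ (λ x y → ℤ.+ x ℤ.- ℤ.+ y) infinities-W infinities-V ⟩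
  ℤ.+ (kept + count (turned (chr a) W) 0 N) ℤ.- ℤ.+ kept
    ≡⟨ +[m+n]-+m kept _ ⟩
  ℤ.+ count (turned (chr a) W) 0 N
    ∎)
  where
  open ≡-Reasoning
  V = chr a ∷ Z
  W = rot1 V
  N = suc (length Z)
  kept = count (λ q → isInf (PDω V (suc q))) 0 N
  W≡ : W ≡ slice (W ^ω) 0 N
  W≡ = trans (sym (slice-omegaAt $ W)) (cong (slice (W ^ω) 0) (length-rot1 V))
  PD-W : PD W ≡ slice (PDω W) 0 N
  PD-W = trans (cong PD W≡) (PD-slice (W ^ω) N)
  aW≡ : chr a ∷ W ≡ slice (V ^ω) 0 (suc N)
  aW≡ = cong (chr a ∷_) (sym (trans (slice-shift (V ^ω) 1 N) (trans (slice-cong (λ q → sym (^ω-rot1 (chr a) Z q)) 0 N) (sym W≡))))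
  PD-aW : drop 1 (PD (chr a ∷ W)) ≡ slice (PDω V) 1 N
  PD-aW = trans (cong (λ X → drop 1 (PD X)) aW≡) (trans (cong (drop 1) (PD-slice (V ^ω) (suc N))) (drop-slice (PDω V) 0 1 N))
  split : ∀ q → boolToℕ (isInf (PDω W q)) ≡ boolToℕ (isInf (PDω V (suc q))) + boolToℕ (turned (chr a) W q)
  split q = trans (isInf-turn (chr a) ((W ^ω) q) q (PDω W q))
                  (cong (λ b → boolToℕ (isInf b) + boolToℕ (turned (chr a) W q)) (sym (PDω-suc (chr a) Z q)))
  infinities-W : rank∞ (slice (PDω W) 0 N) N ≡ kept + count (turned (chr a) W) 0 N
  infinities-W = trans (rank∞-slice (PDω W) 0 N)
                       (count-sum (λ q → isInf (PDω W q)) (λ q → isInf (PDω V (suc q))) (turned (chr a) W) 0 N split)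
  infinities-V : rank∞ (slice (PDω V) 1 N) N ≡ kept
  infinities-V = trans (rank∞-slice (PDω V) 1 N) (count-shift (λ q → isInf (PDω V q)) 0 N)

-- The ω-order as the lexicographic order of PD sequences

_<lex_ : (ℕ → PDSym) → (ℕ → PDSym) → Set
f <lex g = ∃ λ m → (∀ q → q < m → f q ≡ g q) × f m <P g m

<P-irrefl : {a : PDSym} → ¬ a <P a
<P-irrefl (num<num a<a) = <-irrefl refl a<a

<P-trans : {a b c : PDSym} → a <P b → b <P c → a <P c
<P-trans $<num       (num<num _)   = $<num
<P-trans $<num       num<∞         = $<∞
<P-trans (num<num l) (num<num l′)  = num<num (<-trans l l′)
<P-trans (num<num l) num<∞         = num<∞

_≟P_ : (a b : PDSym) → Dec (a ≡ b)
pd$   ≟P pd$   = yes refl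
pd$   ≟P num _ = no λ ()
pd$   ≟P pd∞   = no λ ()
num _ ≟P pd$   = no λ ()
num x ≟P num y with x ≟ y
... | yes refl = yes refl
... | no  x≢y  = no λ { refl → x≢y refl }
num _ ≟P pd∞   = no λ ()
pd∞   ≟P pd$   = no λ ()
pd∞   ≟P num _ = no λ ()
pd∞   ≟P pd∞   = yes refl

<P-connex : (a b : PDSym) → a ≢ b → a <P b ⊎ b <P a
<P-connex pd$     pd$     a≢b = contradiction refl a≢b
<P-connex pd$     (num _) _   = inj₁ $<num
<P-connex pd$     pd∞     _   = inj₁ $<∞
<P-connex (num _) pd$     _   = inj₂ $<num
<P-connex (num x) (num y) a≢b with <-cmp x y
... | tri< x<y _ _ = inj₁ (num<num x<y)
... | tri≈ _ refl _ = contradiction refl a≢b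
... | tri> _ _ y<x = inj₂ (num<num y<x)
<P-connex (num _) pd∞     _   = inj₁ num<∞
<P-connex pd∞     pd$     _   = inj₂ $<∞
<P-connex pd∞     (num _) _   = inj₂ num<∞
<P-connex pd∞     pd∞     a≢b = contradiction refl a≢b

<lex-irrefl : {f g : ℕ → PDSym} → f ≗ g → ¬ f <lex g
<lex-irrefl {f} f≗g (m , _ , fm<gm) = <P-irrefl (subst (f m <P_) (sym (f≗g m)) fm<gm)

<lex-asym : {f g : ℕ → PDSym} → f <lex g → ¬ g <lex f
<lex-asym {f} {g} (m , agree , fm<gm) (m′ , agree′ , gm′<fm′) with <-cmp m m′
... | tri< m<m′ _ _ = <P-irrefl (subst (f m <P_) (agree′ m m<m′) fm<gm)
... | tri≈ _ refl _ = <P-irrefl (<P-trans fm<gm gm′<fm′)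
... | tri> _ _ m′<m = <P-irrefl (subst (g m′ <P_) (agree m′ m′<m) gm′<fm′)

<lex-trans : {f g h : ℕ → PDSym} → f <lex g → g <lex h → f <lex h
<lex-trans {f} {g} {h} (m , agree , fm<gm) (m′ , agree′ , gm′<hm′) with <-cmp m m′
... | tri< m<m′ _ _ = m , (λ q q<m → trans (agree q q<m) (agree′ q (<-trans q<m m<m′))) , subst (f m <P_) (agree′ m m<m′) fm<gm
... | tri≈ _ refl _ = m , (λ q q<m → trans (agree q q<m) (agree′ q q<m)) , <P-trans fm<gm gm′<hm′
... | tri> _ _ m′<m =
  m′ , (λ q q<m′ → trans (agree q (<-trans q<m′ m′<m)) (agree′ q q<m′)) , subst (_<P h m′) (sym (agree m′ m′<m)) gm′<hm′

<lex-resp-≗ : {f f′ g g′ : ℕ → PDSym} → f ≗ f′ → g ≗ g′ → f <lex g → f′ <lex g′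
<lex-resp-≗ f≗f′ g≗g′ (m , agree , fm<gm) =
  m , (λ q q<m → trans (sym (f≗f′ q)) (trans (agree q q<m) (g≗g′ q))) , subst₂ _<P_ (f≗f′ m) (g≗g′ m) fm<gm

first-difference : (f g : ℕ → PDSym) (n : ℕ) →
                   (∀ q → q < n → f q ≡ g q) ⊎ ∃ λ m → (∀ q → q < m → f q ≡ g q) × f m ≢ g m
first-difference f g zero = inj₁ λ q ()
first-difference f g (suc n) with first-difference f g n
... | inj₂ found = inj₂ found
... | inj₁ agree with f n ≟P g n
...   | no  fn≢gn = inj₂ (n , agree , fn≢gn)
...   | yes fn≡gn = inj₁ λ q q<1+n → extend (m≤n⇒m<n∨m≡n (≤-pred q<1+n))
  where
  extend : {q : ℕ} → q < n ⊎ q ≡ n → f q ≡ g q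
  extend (inj₁ q<n)  = agree _ q<n
  extend (inj₂ refl) = fn≡gn

¬¬-<lex-total : (f g : ℕ → PDSym) → DoubleNegation (f <lex g ⊎ f ≗ g ⊎ g <lex f)
¬¬-<lex-total f g = ¬¬-excluded-middle >>= decide
  where
  ¬≗⇒¬¬difference : ¬ f ≗ g → DoubleNegation (∃ λ q → f q ≢ g q)
  ¬≗⇒¬¬difference f≭g no-difference = f≭g λ q → decidable-stable (f q ≟P g q) (λ fq≢gq → no-difference (q , fq≢gq))
  at-difference : (q : ℕ) → f q ≢ g q → f <lex g ⊎ f ≗ g ⊎ g <lex f
  at-difference q fq≢gq with first-difference f g (suc q)
  ... | inj₁ agree = contradiction (agree q ≤-refl) fq≢gq
  ... | inj₂ (m , agree , fm≢gm) with <P-connex (f m) (g m) fm≢gm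
  ...   | inj₁ fm<gm = inj₁ (m , agree , fm<gm)
  ...   | inj₂ gm<fm = inj₂ (inj₂ (m , (λ q q<m → sym (agree q q<m)) , gm<fm))
  decide : Dec (f ≗ g) → DoubleNegation (f <lex g ⊎ f ≗ g ⊎ g <lex f)
  decide (yes f≗g) = pure (inj₂ (inj₁ f≗g))
  decide (no  f≭g) = do
    (q , fq≢gq) ← ¬≗⇒¬¬difference f≭g
    pure (at-difference q fq≢gq)

slice-<L⇒<lex : (f g : ℕ → PDSym) (i : ℕ) → slice f 0 i <L slice g 0 i → f <lex g
slice-<L⇒<lex f g i lt with go lt 0 i refl refl
  where
  go : {xs ys : List PDSym} → xs <L ys → ∀ k i → xs ≡ slice f k i → ys ≡ slice g k i →
       ∃ λ m → (∀ q → k ≤ q → q < m → f q ≡ g q) × f m <P g m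
  go prefix    k zero    _   ()
  go prefix    k (suc i) ()  _
  go (here lt) k (suc i) xs≡ ys≡ =
    k , (λ q k≤q q<k → contradiction (≤-<-trans k≤q q<k) (<-irrefl refl)) , subst₂ _<P_ (∷-injectiveˡ xs≡) (∷-injectiveˡ ys≡) lt
  go (there lt) k (suc i) xs≡ ys≡ with go lt (suc k) i (∷-injectiveʳ xs≡) (∷-injectiveʳ ys≡)
  ... | m , agree , fm<gm = m , agree′ , fm<gm
    where
    agree′ : ∀ q → k ≤ q → q < m → f q ≡ g q
    agree′ q k≤q q<m with m≤n⇒m<n∨m≡n k≤q
    ... | inj₁ k<q  = agree q k<q q<m
    ... | inj₂ refl = trans (sym (∷-injectiveˡ xs≡)) (∷-injectiveˡ ys≡)
... | m , agree , fm<gm = m , (λ q → agree q z≤n) , fm<gm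

<lex⇒slice-<L : {f g : ℕ → PDSym} → (lt : f <lex g) → slice f 0 (suc (proj₁ lt)) <L slice g 0 (suc (proj₁ lt))
<lex⇒slice-<L {f} {g} (m , agree , fm<gm) = go 0 m (λ q _ → agree q) fm<gm
  where
  go : ∀ k d → (∀ q → k ≤ q → q < k + d → f q ≡ g q) → f (k + d) <P g (k + d) → slice f k (suc d) <L slice g k (suc d)
  go k zero    _     lt = here (subst₂ _<P_ (cong f (+-identityʳ k)) (cong g (+-identityʳ k)) lt)
  go k (suc d) agree′ lt =
    subst (λ x → (f k ∷ slice f (suc k) (suc d)) <L (x ∷ slice g (suc k) (suc d))) (agree′ k ≤-refl (m<m+n k z<s))
      (there (go (suc k) d (λ q k<q q<end → agree′ q (<⇒≤ k<q) (subst (q <_) (sym (+-suc k d)) q<end))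
                           (subst (λ n → f n <P g n) (+-suc k d) lt)))

⪯ω⇒≤lex : {V U : List Sym} → V ≢ [] → U ≢ [] → V ⪯ω U → PDω V <lex PDω U ⊎ PDω V ≗ PDω U
⪯ω⇒≤lex {V} {U} V≢[] U≢[] (inj₁ (i , lt)) =
  inj₁ (slice-<L⇒<lex (PDω V) (PDω U) i (subst₂ _<L_ (PD-omegaPrefix V V≢[] i) (PD-omegaPrefix U U≢[] i) lt))
⪯ω⇒≤lex V≢[] U≢[] (inj₂ same-root) = inj₂ (RPDω-≗⇒PDω-≗ V≢[] U≢[] (SameRoot⇒RPDω-≗ V≢[] U≢[] same-root))

<lex⇒⪯ω : {V U : List Sym} → V ≢ [] → U ≢ [] → PDω V <lex PDω U → V ⪯ω U
<lex⇒⪯ω {V} {U} V≢[] U≢[] lt =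
  inj₁ (suc (proj₁ lt) , subst₂ _<L_ (sym (PD-omegaPrefix V V≢[] _)) (sym (PD-omegaPrefix U U≢[] _)) (<lex⇒slice-<L lt))

≗⇒¬¬⪯ω : {V U : List Sym} → V ≢ [] → U ≢ [] → PDω V ≗ PDω U → DoubleNegation (V ⪯ω U)
≗⇒¬¬⪯ω V≢[] U≢[] V≗U = do
  same-root ← RPDω-≗⇒¬¬SameRoot V≢[] U≢[] (PDω-≗⇒RPDω-≗ V≢[] U≢[] V≗U)
  pure (inj₂ same-root)

=ω⇒≗ : {V U : List Sym} → V ≢ [] → U ≢ [] → V =ω U → PDω V ≗ PDω U
=ω⇒≗ V≢[] U≢[] (V⪯U , U⪯V) with ⪯ω⇒≤lex V≢[] U≢[] V⪯U | ⪯ω⇒≤lex U≢[] V≢[] U⪯V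
... | inj₂ V≗U | _        = V≗U
... | inj₁ V<U | inj₁ U<V = contradiction U<V (<lex-asym V<U)
... | inj₁ V<U | inj₂ U≗V = contradiction V<U (<lex-irrefl (λ q → sym (U≗V q)))

≗⇒¬¬=ω : {V U : List Sym} → V ≢ [] → U ≢ [] → PDω V ≗ PDω U → DoubleNegation (V =ω U)
≗⇒¬¬=ω V≢[] U≢[] V≗U = do
  V⪯U ← ≗⇒¬¬⪯ω V≢[] U≢[] V≗U
  U⪯V ← ≗⇒¬¬⪯ω U≢[] V≢[] (λ q → sym (V≗U q))
  pure (V⪯U , U⪯V)

¬=ω⇒≭ : {V U : List Sym} → V ≢ [] → U ≢ [] → ¬ V =ω U → ¬ PDω V ≗ PDω U
¬=ω⇒≭ V≢[] U≢[] V≠U V≗U = ≗⇒¬¬=ω V≢[] U≢[] V≗U V≠U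

≺ω⇒<lex : {V U : List Sym} → V ≢ [] → U ≢ [] → V ≺ω U → PDω V <lex PDω U
≺ω⇒<lex V≢[] U≢[] (V⪯U , V≠U) with ⪯ω⇒≤lex V≢[] U≢[] V⪯U
... | inj₁ V<U = V<U
... | inj₂ V≗U = contradiction V≗U (¬=ω⇒≭ V≢[] U≢[] V≠U)

<lex⇒≺ω : {V U : List Sym} → V ≢ [] → U ≢ [] → PDω V <lex PDω U → V ≺ω U
<lex⇒≺ω V≢[] U≢[] V<U = <lex⇒⪯ω V≢[] U≢[] V<U , λ V=U → <lex-irrefl (=ω⇒≗ V≢[] U≢[] V=U) V<U

-- Equal π values transfer the order from rot1 V, rot1 U to V, U

π-$≢π-chr : (Z : List Sym) (b : ℕ) (Z′ : List Sym) → π ($ ∷ Z) ≢ π (chr b ∷ Z′)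
π-$≢π-chr Z b Z′ eq with trans eq (π-turned b Z′)
... | ()

val-injective : {x y : ℤ.ℤ} → val x ≡ val y → x ≡ y
val-injective refl = refl

π-≡⇒turned-≡ : (a : ℕ) (Z : List Sym) (b : ℕ) (Z′ : List Sym) → π (chr a ∷ Z) ≡ π (chr b ∷ Z′) →
               count (turned (chr a) (rot1 (chr a ∷ Z))) 0 (length (rot1 (chr a ∷ Z)))
               ≡ count (turned (chr b) (rot1 (chr b ∷ Z′))) 0 (length (rot1 (chr b ∷ Z′)))
π-≡⇒turned-≡ a Z b Z′ eq = begin
  count (turned (chr a) W) 0 (length W)       ≡⟨ cong (count (turned (chr a) W) 0) (length-rot1 (chr a ∷ Z)) ⟩
  count (turned (chr a) W) 0 (suc (length Z))  ≡⟨ ℤₚ.+-injective (val-injective (trans (sym (π-turned a Z)) (trans eq (π-turned b Z′)))) ⟩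
  count (turned (chr b) W′) 0 (suc (length Z′)) ≡⟨ cong (count (turned (chr b) W′) 0) (length-rot1 (chr b ∷ Z′)) ⟨
  count (turned (chr b) W′) 0 (length W′)     ∎
  where
  open ≡-Reasoning
  W = rot1 (chr a ∷ Z)
  W′ = rot1 (chr b ∷ Z′)

turn-agree : {W W′ : List Sym} → W ≢ [] → W′ ≢ [] → (a b p : ℕ) →
             count (turned (chr a) W) 0 (length W) ≡ count (turned (chr b) W′) 0 (length W′) →
             (∀ q → q ≤ p → PDω W q ≡ PDω W′ q) →
             turn (chr a) ((W ^ω) p) p (PDω W p) ≡ turn (chr b) ((W′ ^ω) p) p (PDω W′ p)
turn-agree {W} {W′} W≢[] W′≢[] a b p same-count agree
  with PDω W p in p-W | PDω W′ p in p-W′ | agree p ≤-refl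
... | pd$   | _ | refl = refl
... | num e | _ | refl = refl
... | pd∞   | _ | refl = cong (if_then num (suc p) else pd∞) (begin
  chr a ≤S (W ^ω) p                                                            ≡⟨ turned-char (chr a) W≢[] p-W ⟩
  count (λ q → isInf (PDω W q)) 0 p <ᵇ count (turned (chr a) W) 0 (length W)   ≡⟨ cong₂ _<ᵇ_ same-infinities same-count ⟩
  count (λ q → isInf (PDω W′ q)) 0 p <ᵇ count (turned (chr b) W′) 0 (length W′) ≡⟨ turned-char (chr b) W′≢[] p-W′ ⟨
  chr b ≤S (W′ ^ω) p                                                           ∎)
  where
  open ≡-Reasoning
  same-infinities : count (λ q → isInf (PDω W q)) 0 p ≡ count (λ q → isInf (PDω W′ q)) 0 p
  same-infinities = count-cong _ _ 0 p (λ q q<p → cong isInf (agree q (<⇒≤ q<p)))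

π-≡⇒PDω-agree : {V U : List Sym} → V ≢ [] → U ≢ [] → π V ≡ π U → ∀ p →
                (∀ q → q < p → PDω (rot1 V) q ≡ PDω (rot1 U) q) → PDω V p ≡ PDω U p
π-≡⇒PDω-agree {[]}         V≢[] _ _ _ _ = contradiction refl V≢[]
π-≡⇒PDω-agree {_ ∷ _} {[]} _ U≢[] _ _ _ = contradiction refl U≢[]
π-≡⇒PDω-agree {$ ∷ Z}     {$ ∷ Z′}     _ _ _ zero    _     = refl
π-≡⇒PDω-agree {$ ∷ Z}     {$ ∷ Z′}     _ _ _ (suc p) agree =
  trans (PDω-suc $ Z p) (trans (cong (_orElse num (suc p)) (agree p ≤-refl)) (sym (PDω-suc $ Z′ p)))
π-≡⇒PDω-agree {chr a ∷ Z} {chr b ∷ Z′} _ _ _ zero    _     = refl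
π-≡⇒PDω-agree {chr a ∷ Z} {chr b ∷ Z′} _ _ π≡ (suc p) agree =
  trans (PDω-suc (chr a) Z p)
        (trans (turn-agree (rot-≢[] 1 {chr a ∷ Z} (λ ())) (rot-≢[] 1 {chr b ∷ Z′} (λ ())) a b p
                           (π-≡⇒turned-≡ a Z b Z′ π≡) (λ q q≤p → agree q (s≤s q≤p)))
               (sym (PDω-suc (chr b) Z′ p)))
π-≡⇒PDω-agree {$ ∷ Z}     {chr b ∷ Z′} _ _ π≡ _ _ = contradiction π≡ (π-$≢π-chr Z b Z′)
π-≡⇒PDω-agree {chr a ∷ Z} {$ ∷ Z′}     _ _ π≡ _ _ = contradiction (sym π≡) (π-$≢π-chr Z′ a Z)

π-≡-lift-≗ : {V U : List Sym} → V ≢ [] → U ≢ [] → π V ≡ π U → PDω (rot1 V) ≗ PDω (rot1 U) → PDω V ≗ PDω U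
π-≡-lift-≗ V≢[] U≢[] π≡ agree p = π-≡⇒PDω-agree V≢[] U≢[] π≡ p (λ q _ → agree q)

turn-<P : (c d x y : Sym) (m : ℕ) {a b : PDSym} → a <P b → (∀ {e} → a ≡ num e → e ≤ m) → turn c x m a <P turn d y m b
turn-<P c d x y m $<num         _   = $<num
turn-<P c d x y m $<∞           _   with d ≤S y
... | true  = $<num
... | false = $<∞
turn-<P c d x y m (num<num e<f) _   = num<num e<f
turn-<P c d x y m num<∞         e≤m with d ≤S y
... | true  = num<num (s≤s (e≤m refl))
... | false = num<∞

π-≡-lift-<lex : {V U : List Sym} → V ≢ [] → U ≢ [] → π V ≡ π U → PDω (rot1 V) <lex PDω (rot1 U) → PDω V <lex PDω U
π-≡-lift-<lex {[]}         V≢[] _ _ _ = contradiction refl V≢[]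
π-≡-lift-<lex {_ ∷ _} {[]} _ U≢[] _ _ = contradiction refl U≢[]
π-≡-lift-<lex {c ∷ Z} {c′ ∷ Z′} V≢[] U≢[] π≡ (m , agree , lt) = suc m , agree′ , lt′
  where
  agree′ : ∀ q → q < suc m → PDω (c ∷ Z) q ≡ PDω (c′ ∷ Z′) q
  agree′ q q≤m = π-≡⇒PDω-agree V≢[] U≢[] π≡ q (λ j j<q → agree j (<-≤-trans j<q (≤-pred q≤m)))
  lt′ : PDω (c ∷ Z) (suc m) <P PDω (c′ ∷ Z′) (suc m)
  lt′ = subst₂ _<P_ (sym (PDω-suc c Z m)) (sym (PDω-suc c′ Z′ m))
          (turn-<P c c′ _ _ m lt (λ eq → proj₂ (PDseq-range (rot1 (c ∷ Z) ^ω) m eq)))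

-- Positions of T and prev

-- Position i of T is letter offset + 1 of the word occupying positions start + 1 .. start + length word.
record Block (T : List (List Sym)) (i : ℕ) : Set where
  constructor mkBlock
  field
    start    : ℕ
    word     : List Sym
    offset   : ℕ
    position : i ≡ start + suc offset
    offset<length   : offset < length word
    conj≡    : ∀ o → o < length word → conj T (start + suc o) ≡ rot o word
    strOf≡   : ∀ o → o < length word → strOf T (start + suc o) ≡ word
    end≤total     : start + length word ≤ totalLength T

open Block

conj-here : (t : List Sym) (ts : List (List Sym)) {i : ℕ} → i ≤ length t → conj (t ∷ ts) i ≡ rot (i ∸ 1) t
conj-here t ts i≤n rewrite ≤ᵇ-true i≤n = refl

conj-there : (t : List Sym) (ts : List (List Sym)) {i : ℕ} → length t < i → conj (t ∷ ts) i ≡ conj ts (i ∸ length t)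
conj-there t ts {i} n<i rewrite ≤ᵇ-false {i} {length t} n<i = refl

strOf-here : (t : List Sym) (ts : List (List Sym)) {i : ℕ} → i ≤ length t → strOf (t ∷ ts) i ≡ t
strOf-here t ts i≤n rewrite ≤ᵇ-true i≤n = refl

strOf-there : (t : List Sym) (ts : List (List Sym)) {i : ℕ} → length t < i → strOf (t ∷ ts) i ≡ strOf ts (i ∸ length t)
strOf-there t ts {i} n<i rewrite ≤ᵇ-false {i} {length t} n<i = refl

block-here : (t : List Sym) (ts : List (List Sym)) {i : ℕ} → 1 ≤ i → i ≤ length t → Block (t ∷ ts) i
block-here t ts {i} 1≤i i≤n = mkBlock 0 t (i ∸ 1) (sym (m+[n∸m]≡n 1≤i)) (≤-trans (≤-reflexive (m+[n∸m]≡n 1≤i)) i≤n)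
  (λ o o<n → conj-here t ts o<n) (λ o o<n → strOf-here t ts o<n) (m≤m+n (length t) _)

block-there : (t : List Sym) (ts : List (List Sym)) {i : ℕ} → length t < i → Block ts (i ∸ length t) → Block (t ∷ ts) i
block-there t ts {i} n<i (mkBlock s w o pos o<n conj≡′ strOf≡′ fits′) =
  mkBlock (length t + s) w o pos′ o<n
    (λ o′ o′<n → trans (conj-there t ts (beyond o′)) (trans (cong (conj ts) (shift o′)) (conj≡′ o′ o′<n)))
    (λ o′ o′<n → trans (strOf-there t ts (beyond o′)) (trans (cong (strOf ts) (shift o′)) (strOf≡′ o′ o′<n)))
    (subst (_≤ length t + totalLength ts) (sym (+-assoc (length t) s (length w))) (+-monoʳ-≤ (length t) fits′))
  where
  pos′ : i ≡ length t + s + suc o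
  pos′ = trans (sym (m+[n∸m]≡n (<⇒≤ n<i))) (trans (cong (length t +_) pos) (sym (+-assoc (length t) s (suc o))))
  beyond : ∀ o′ → length t < length t + s + suc o′
  beyond o′ = subst (length t <_) (sym (+-assoc (length t) s (suc o′))) (m<m+n (length t) (≤-trans z<s (m≤n+m (suc o′) s)))
  shift : ∀ o′ → length t + s + suc o′ ∸ length t ≡ s + suc o′
  shift o′ = trans (cong (_∸ length t) (+-assoc (length t) s (suc o′))) (m+n∸m≡n (length t) (s + suc o′))

tail-bounds : (t : List Sym) (ts : List (List Sym)) {i : ℕ} → ¬ i ≤ length t → i ≤ totalLength (t ∷ ts) →
              1 ≤ i ∸ length t × i ∸ length t ≤ totalLength ts
tail-bounds t ts {i} i≰n i≤total =
  m<n⇒0<n∸m (≰⇒> i≰n) , subst (_ ≤_) (m+n∸m≡n (length t) (totalLength ts)) (∸-monoˡ-≤ (length t) i≤total)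

block : (T : List (List Sym)) {i : ℕ} → 1 ≤ i → i ≤ totalLength T → Block T i
block []       1≤i i≤0 = contradiction i≤0 (<⇒≱ 1≤i)
block (t ∷ ts) {i} 1≤i i≤total with i ≤? length t
... | yes i≤n = block-here t ts 1≤i i≤n
... | no  i≰n = block-there t ts (≰⇒> i≰n) (uncurry (block ts) (tail-bounds t ts i≰n i≤total))

SameOrBefore : {T : List (List Sym)} {x y : ℕ} → Block T x → Block T y → Set
SameOrBefore bx by = (start bx ≡ start by × word bx ≡ word by) ⊎ start bx + length (word bx) ≤ start by

blocks-ordered : (T : List (List Sym)) {x y : ℕ} → 1 ≤ x → x < y → y ≤ totalLength T →
                 ∃₂ λ (bx : Block T x) (by : Block T y) → SameOrBefore bx by
blocks-ordered [] 1≤x x<y y≤0 = contradiction y≤0 (<⇒≱ (<-≤-trans 1≤x (<⇒≤ x<y)))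
blocks-ordered (t ∷ ts) {x} {y} 1≤x x<y y≤total with y ≤? length t | x ≤? length t
... | yes y≤n | _ =
  block-here t ts 1≤x (≤-trans (<⇒≤ x<y) y≤n) , block-here t ts (≤-trans 1≤x (<⇒≤ x<y)) y≤n , inj₁ (refl , refl)
... | no y≰n | yes x≤n =
  block-here t ts 1≤x x≤n , block-there t ts (≰⇒> y≰n) by′ , inj₂ (m≤m+n (length t) (start by′))
  where
  by′ = uncurry (block ts) (tail-bounds t ts y≰n y≤total)
... | no y≰n | no x≰n
  with blocks-ordered ts (proj₁ (tail-bounds t ts x≰n (≤-trans (<⇒≤ x<y) y≤total))) (∸-monoˡ-< x<y (<⇒≤ (≰⇒> x≰n)))
                         (proj₂ (tail-bounds t ts y≰n y≤total))
...   | bx , by , order = block-there t ts (≰⇒> x≰n) bx , block-there t ts (≰⇒> y≰n) by , shift order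
  where
  shift : SameOrBefore bx by → SameOrBefore (block-there t ts (≰⇒> x≰n) bx) (block-there t ts (≰⇒> y≰n) by)
  shift (inj₁ (same-start , same-word)) = inj₁ (cong (length t +_) same-start , same-word)
  shift (inj₂ before) = inj₂ (subst (_≤ length t + start by) (sym (+-assoc (length t) (start bx) (length (word bx))))
                                    (+-monoʳ-≤ (length t) before))

PrevCase : List (List Sym) → ℕ → List Sym → ℕ → Set
PrevCase T x w p = (PDω (conj T x) ≗ PDω w × ∃ λ Y → IsRoot Y (RPD w) × p ≡ x ∸ 1 + length Y)
                 ⊎ (¬ PDω (conj T x) ≗ PDω w × p ≡ x ∸ 1)

conj-block : {T : List (List Sym)} {x : ℕ} (b : Block T x) → conj T x ≡ rot (offset b) (word b)
conj-block (mkBlock s w o refl o<n conj≡′ _ _) = conj≡′ o o<n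

strOf-block : {T : List (List Sym)} {x : ℕ} (b : Block T x) → strOf T x ≡ word b
strOf-block (mkBlock s w o refl o<n _ strOf≡′ _) = strOf≡′ o o<n

word-≢[] : {T : List (List Sym)} {x : ℕ} (b : Block T x) → word b ≢ []
word-≢[] b refl = contradiction (offset<length b) λ ()

conj-≢[] : {T : List (List Sym)} {x : ℕ} → Block T x → conj T x ≢ []
conj-≢[] b = subst (_≢ []) (sym (conj-block b)) (rot-≢[] (offset b) (word-≢[] b))

prevRel⇒prevCase : (T : List (List Sym)) {x p : ℕ} (b : Block T x) → PrevRel T x p → PrevCase T x (word b) p
prevRel⇒prevCase T {x} b (inj₁ (x=ω , Y , Y-root , p≡)) =
  inj₁ (=ω⇒≗ (conj-≢[] b) (word-≢[] b) (subst (conj T x =ω_) (strOf-block b) x=ω) ,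
        Y , subst (λ w → IsRoot Y (RPD w)) (strOf-block b) Y-root , p≡)
prevRel⇒prevCase T {x} b (inj₂ (x≠ω , p≡)) =
  inj₂ (¬=ω⇒≭ (conj-≢[] b) (word-≢[] b) (λ x=ω → x≠ω (subst (conj T x =ω_) (sym (strOf-block b)) x=ω)) , p≡)

root-divides-offset : {t : List Sym} {Y : List PDSym} → t ≢ [] → IsRoot Y (RPD t) →
                      (o : ℕ) → PDω (rot o t) ≗ PDω t → length Y ∣ o
root-divides-offset {t} {Y} t≢[] (prim , k , RPD≡) o rot≗ = primitive-period pd$ prim shift
  where
  RPDω≗Yω : RPDω t ≗ omegaAt pd$ Y
  RPDω≗Yω = omegaAt-powA pd$ Y k RPD≡ (RPD-≢[] t≢[])
  shift : ∀ q → omegaAt pd$ Y (o + q) ≡ omegaAt pd$ Y q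
  shift q = begin
    omegaAt pd$ Y (o + q)  ≡⟨ RPDω≗Yω (o + q) ⟨
    RPDω t (o + q)         ≡⟨ RPDω-rot o t≢[] q ⟨
    RPDω (rot o t) q       ≡⟨ PDω-≗⇒RPDω-≗ (rot-≢[] o t≢[]) t≢[] rot≗ q ⟩
    RPDω t q               ≡⟨ RPDω≗Yω q ⟩
    omegaAt pd$ Y q        ∎
    where open ≡-Reasoning

rot-+-root : {t : List Sym} {Y : List PDSym} → t ≢ [] → IsRoot Y (RPD t) → (o : ℕ) → PDω (rot (o + length Y) t) ≗ PDω (rot o t)
rot-+-root {t} {Y} t≢[] (prim , k , RPD≡) o = RPDω-≗⇒PDω-≗ (rot-≢[] (o + length Y) t≢[]) (rot-≢[] o t≢[]) same
  where
  r = length Y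
  RPDω≗Yω : RPDω t ≗ omegaAt pd$ Y
  RPDω≗Yω = omegaAt-powA pd$ Y k RPD≡ (RPD-≢[] t≢[])
  same : RPDω (rot (o + r) t) ≗ RPDω (rot o t)
  same q = begin
    RPDω (rot (o + r) t) q      ≡⟨ RPDω-rot (o + r) t≢[] q ⟩
    RPDω t (o + r + q)          ≡⟨ RPDω≗Yω (o + r + q) ⟩
    omegaAt pd$ Y (o + r + q)   ≡⟨ cong (omegaAt pd$ Y) (trans (cong (_+ q) (+-comm o r)) (+-assoc r o q)) ⟩
    omegaAt pd$ Y (r + (o + q)) ≡⟨ omegaAt-periodic pd$ Y (o + q) ⟩
    omegaAt pd$ Y (o + q)       ≡⟨ RPDω≗Yω (o + q) ⟨
    RPDω t (o + q)              ≡⟨ RPDω-rot o t≢[] q ⟨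
    RPDω (rot o t) q            ∎
    where open ≡-Reasoning

∣-<-*⇒+-≤ : {r o k : ℕ} → r ∣ o → o < k * r → o + r ≤ k * r
∣-<-*⇒+-≤ {r} {o} {k} (divides m refl) m*r<k*r =
  subst (_≤ k * r) (+-comm r (m * r)) (*-monoˡ-≤ r (*-cancelʳ-< r m k m*r<k*r))

record PrevFacts (T : List (List Sym)) {x : ℕ} (b : Block T x) (p : ℕ) : Set where
  field
    start<p    : start b < p
    p≤end      : p ≤ start b + length (word b)
    rot1≗      : PDω (rot1 (conj T p)) ≗ PDω (conj T x)
    p-nonempty : conj T p ≢ []

open PrevFacts

prevFacts-at : {T : List (List Sym)} {x : ℕ} (b : Block T x) {p : ℕ} (o : ℕ) → o < length (word b) →
               p ≡ start b + suc o → PDω (rot (suc o) (word b)) ≗ PDω (rot (offset b) (word b)) → PrevFacts T b p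
prevFacts-at {T} b o o<n refl rot≗ = record
  { start<p    = m<m+n (start b) z<s
  ; p≤end      = +-monoʳ-≤ (start b) o<n
  ; rot1≗      = λ q → trans (cong (λ V → PDω (rot1 V) q) (conj≡ b o o<n))
                             (trans (rot≗ q) (cong (λ V → PDω V q) (sym (conj-block b))))
  ; p-nonempty = subst (_≢ []) (sym (conj≡ b o o<n)) (rot-≢[] o (word-≢[] b))
  }

prevFacts : (T : List (List Sym)) {x p : ℕ} (b : Block T x) → PrevCase T x (word b) p → PrevFacts T b p
prevFacts T b@(mkBlock s w zero refl o<n conj≡′ _ _) (inj₂ (x≭w , _)) =
  contradiction (λ q → cong (λ V → PDω V q) (conj≡′ 0 o<n)) x≭w
prevFacts T b@(mkBlock s w (suc o) refl o<n conj≡′ _ _) (inj₂ (_ , p≡)) =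
  prevFacts-at b o (<-trans (n<1+n o) o<n) (trans p≡ (cong (_∸ 1) (+-suc s (suc o)))) (λ q → refl)
prevFacts T b@(mkBlock s w o refl o<n conj≡′ _ _) (inj₁ (x≗w , Y , Y-root@(prim , k , RPD≡) , p≡)) =
  prevFacts-at b (o + r ∸ 1) o+r-1<n p≡′ (λ q → trans (cong (λ n → PDω (rot n w) q) o+r≡) (rot-+-root w≢[] Y-root o q))
  where
  r = length Y
  w≢[] = word-≢[] b
  1≤r : 1 ≤ r
  1≤r = >-nonZero⁻¹ r {{length-nonZero (proj₁ prim)}}
  o+r≡ : suc (o + r ∸ 1) ≡ o + r
  o+r≡ = m+[n∸m]≡n (≤-trans 1≤r (m≤n+m r o))
  n≡k*r : length w ≡ k * r
  n≡k*r = trans (sym (length-RPD w)) (trans (cong length RPD≡) (length-powA Y k))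
  r∣o : r ∣ o
  r∣o = root-divides-offset w≢[] Y-root o (λ q → trans (cong (λ V → PDω V q) (sym (conj≡′ o o<n))) (x≗w q))
  o+r-1<n : o + r ∸ 1 < length w
  o+r-1<n = subst (_≤ length w) (sym o+r≡) (subst (o + r ≤_) (sym n≡k*r) (∣-<-*⇒+-≤ {k = k} r∣o (subst (o <_) n≡k*r o<n)))
  p≡′ : _ ≡ s + suc (o + r ∸ 1)
  p≡′ = trans p≡ (trans (cong (λ n → n ∸ 1 + r) (+-suc s o)) (trans (+-assoc s o r) (cong (s +_) (sym o+r≡))))

prev-preserves-<-on-ties : (T : List (List Sym)) {x y px py : ℕ} → 1 ≤ x → x < y → y ≤ totalLength T →
           PDω (conj T x) ≗ PDω (conj T y) → PrevRel T x px → PrevRel T y py → px < py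
prev-preserves-<-on-ties T {x} {y} {px} {py} 1≤x x<y y≤n x≗y prev-x prev-y with blocks-ordered T 1≤x x<y y≤n
... | bx , by , order = compare order (prevRel⇒prevCase T bx prev-x) (prevRel⇒prevCase T by prev-y)
  where
  x-1<y-1 : x ∸ 1 < y ∸ 1
  x-1<y-1 = ∸-monoˡ-< x<y 1≤x
  compare : SameOrBefore bx by → PrevCase T x (word bx) px → PrevCase T y (word by) py → px < py
  compare (inj₂ before) case-x case-y =
    ≤-<-trans (≤-trans (p≤end (prevFacts T bx case-x)) before) (start<p (prevFacts T by case-y))
  compare (inj₁ (_ , same)) (inj₁ (_ , Y₁ , root₁ , px≡)) (inj₁ (_ , Y₂ , root₂ , py≡)) =
    subst₂ _<_ (sym px≡) (sym py≡) (subst (λ Y → x ∸ 1 + length Y₁ < y ∸ 1 + length Y) Y₁≡Y₂ (+-monoˡ-< (length Y₁) x-1<y-1))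
    where
    Y₁≡Y₂ : Y₁ ≡ Y₂
    Y₁≡Y₂ = root-unique pd$ (RPD-≢[] (word-≢[] bx)) root₁ (subst (λ w → IsRoot Y₂ (RPD w)) (sym same) root₂)
  compare (inj₁ _) (inj₂ (_ , px≡)) (inj₂ (_ , py≡)) = subst₂ _<_ (sym px≡) (sym py≡) x-1<y-1
  compare (inj₁ (_ , same)) (inj₁ (x≗w , _)) (inj₂ (y≭w , _)) =
    contradiction (λ q → trans (sym (x≗y q)) (trans (x≗w q) (cong (λ w → PDω w q) same))) y≭w
  compare (inj₁ (_ , same)) (inj₂ (x≭w , _)) (inj₁ (y≗w , _)) =
    contradiction (λ q → trans (x≗y q) (trans (y≗w q) (cong (λ w → PDω w q) (sym same)))) x≭w

-- The order sorted by CA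

Precedes : List (List Sym) → ℕ → ℕ → Set
Precedes T k j = PDω (conj T k) <lex PDω (conj T j) ⊎ (PDω (conj T k) ≗ PDω (conj T j) × k < j)

precedes-irrefl : (T : List (List Sym)) {k : ℕ} → ¬ Precedes T k k
precedes-irrefl T (inj₁ k<k)       = <lex-irrefl (λ _ → refl) k<k
precedes-irrefl T (inj₂ (_ , k<k)) = <-irrefl refl k<k

precedes-trans : (T : List (List Sym)) {a b c : ℕ} → Precedes T a b → Precedes T b c → Precedes T a c
precedes-trans T (inj₁ a<b)         (inj₁ b<c)         = inj₁ (<lex-trans a<b b<c)
precedes-trans T (inj₁ a<b)         (inj₂ (b≗c , _))   = inj₁ (<lex-resp-≗ (λ _ → refl) b≗c a<b)
precedes-trans T (inj₂ (a≗b , _))   (inj₁ b<c)         = inj₁ (<lex-resp-≗ (λ q → sym (a≗b q)) (λ _ → refl) b<c)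
precedes-trans T (inj₂ (a≗b , a<b)) (inj₂ (b≗c , b<c)) = inj₂ ((λ q → trans (a≗b q) (b≗c q)) , <-trans a<b b<c)

¬¬-precedes-total : (T : List (List Sym)) {k j : ℕ} → k ≢ j → DoubleNegation (Precedes T k j ⊎ Precedes T j k)
¬¬-precedes-total T {k} {j} k≢j = do
  order ← ¬¬-<lex-total (PDω (conj T k)) (PDω (conj T j))
  pure (from-lex order)
  where
  from-lex : PDω (conj T k) <lex PDω (conj T j) ⊎ PDω (conj T k) ≗ PDω (conj T j) ⊎ PDω (conj T j) <lex PDω (conj T k) →
             Precedes T k j ⊎ Precedes T j k
  from-lex (inj₁ k<j)        = inj₁ (inj₁ k<j)
  from-lex (inj₂ (inj₂ j<k)) = inj₂ (inj₁ j<k)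
  from-lex (inj₂ (inj₁ k≗j)) with <-cmp k j
  ... | tri< k<j _ _ = inj₁ (inj₂ (k≗j , k<j))
  ... | tri≈ _ k≡j _ = contradiction k≡j k≢j
  ... | tri> _ _ j<k = inj₂ (inj₂ ((λ q → sym (k≗j q)) , j<k))

conj-inRange-≢[] : (T : List (List Sym)) {k : ℕ} → InRange (totalLength T) k → conj T k ≢ []
conj-inRange-≢[] T (1≤k , k≤n) = conj-≢[] (block T 1≤k k≤n)

before⇒precedes : (T : List (List Sym)) {j k : ℕ} → InRange (totalLength T) j → InRange (totalLength T) k →
                  Before T j k → Precedes T k j
before⇒precedes T rj rk (inj₁ k≺j)         = inj₁ (≺ω⇒<lex (conj-inRange-≢[] T rk) (conj-inRange-≢[] T rj) k≺j)
before⇒precedes T rj rk (inj₂ (k=j , k<j)) = inj₂ (=ω⇒≗ (conj-inRange-≢[] T rk) (conj-inRange-≢[] T rj) k=j , k<j)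

precedes⇒¬¬before : (T : List (List Sym)) {j k : ℕ} → InRange (totalLength T) j → InRange (totalLength T) k →
                    Precedes T k j → DoubleNegation (Before T j k)
precedes⇒¬¬before T rj rk (inj₁ k<j) = pure (inj₁ (<lex⇒≺ω (conj-inRange-≢[] T rk) (conj-inRange-≢[] T rj) k<j))
precedes⇒¬¬before T rj rk (inj₂ (k≗j , k<j)) = do
  k=j ← ≗⇒¬¬=ω (conj-inRange-≢[] T rk) (conj-inRange-≢[] T rj) k≗j
  pure (inj₂ (k=j , k<j))

rank : (T : List (List Sym)) {CA : ℕ → ℕ} → CASpec T CA → {i x : ℕ} → InRange (totalLength T) i → CA i ≡ x →
       CountIs (totalLength T) (Before T x) (i ∸ 1)
rank T spec {i} ri refl = Equivalence.to (proj₂ (spec i ri) _ (proj₁ (spec i ri))) refl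

precedes⇒rank-< : (T : List (List Sym)) {j j′ m m′ : ℕ} → InRange (totalLength T) j → InRange (totalLength T) j′ →
                  CountIs (totalLength T) (Before T j) m → CountIs (totalLength T) (Before T j′) m′ →
                  Precedes T j j′ → m < m′
precedes⇒rank-< T rj rj′ count-j count-j′ j≺j′ =
  count-< count-j count-j′
    (λ z rz z-before-j → precedes⇒¬¬before T rj′ rz (precedes-trans T (before⇒precedes T rj rz z-before-j) j≺j′))
    rj (precedes⇒¬¬before T rj′ rj j≺j′) (λ j-before-j → precedes-irrefl T (before⇒precedes T rj rj j-before-j))

prevFacts-inRange : (T : List (List Sym)) {x p : ℕ} → InRange (totalLength T) x → PrevRel T x p →
                    ∃ λ (b : Block T x) → PrevFacts T b p
prevFacts-inRange T (1≤x , x≤n) prev = b , prevFacts T b (prevRel⇒prevCase T b prev)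
  where
  b = block T 1≤x x≤n

prev-inRange : (T : List (List Sym)) {x p : ℕ} → InRange (totalLength T) x → PrevRel T x p → InRange (totalLength T) p
prev-inRange T rx prev with prevFacts-inRange T rx prev
... | b , facts = ≤-trans (s≤s z≤n) (start<p facts) , ≤-trans (p≤end facts) (end≤total b)

prev-preserves-precedes : (T : List (List Sym)) {x y px py : ℕ} → InRange (totalLength T) x → InRange (totalLength T) y →
                          PrevRel T x px → PrevRel T y py → π (conj T px) ≡ π (conj T py) →
                          Precedes T x y → Precedes T px py
prev-preserves-precedes T rx ry prev-x prev-y π≡ x≺y
  with prevFacts-inRange T rx prev-x | prevFacts-inRange T ry prev-y | x≺y
... | _ , fx | _ , fy | inj₁ x<y =
  inj₁ (π-≡-lift-<lex (p-nonempty fx) (p-nonempty fy) π≡ (<lex-resp-≗ (λ q → sym (rot1≗ fx q)) (λ q → sym (rot1≗ fy q)) x<y))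
... | _ , fx | _ , fy | inj₂ (x≗y , x<y) =
  inj₂ (π-≡-lift-≗ (p-nonempty fx) (p-nonempty fy) π≡ (λ q → trans (rot1≗ fx q) (trans (x≗y q) (sym (rot1≗ fy q)))) ,
        prev-preserves-<-on-ties T (proj₁ rx) x<y (proj₂ ry) x≗y prev-x prev-y)

ICA-inverse : (T : List (List Sym)) {CA ICA : ℕ → ℕ} → ICASpec T CA ICA → {p a : ℕ} → InRange (totalLength T) p →
              ICA p ≡ a → InRange (totalLength T) a × CA a ≡ p
ICA-inverse T (_ , CA∘ICA) rp refl = CA∘ICA _ rp

∸1-cancel-< : {m n : ℕ} → m ∸ 1 < n ∸ 1 → m < n
∸1-cancel-< {zero}  {suc n} _  = z<s
∸1-cancel-< {suc m} {suc n} lt = s≤s lt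

corollary10 : (σ : ℕ) (T : List (List Sym)) →
    T ≢ [] → All (λ t → t ≢ []) T → All (All (InΣ$ σ)) T →
    (CA ICA : ℕ → ℕ) → CASpec T CA → ICASpec T CA ICA →
    (i j : ℕ) → 1 ≤ i → i < j → j ≤ totalLength T →
    (a b : ℕ) → IsLF T CA ICA i a → IsLF T CA ICA j b →
    Lval T CA a ≡ Lval T CA b → a < b
corollary10 _ T _ _ _ CA ICA spec ica i j 1≤i i<j j≤n a b (px , prev-x , ICApx≡a) (py , prev-y , ICApy≡b) L≡ =
  decidable-stable (a <? b) ¬¬a<b
  where
  ri = 1≤i , ≤-trans (<⇒≤ i<j) j≤n
  rj = ≤-trans 1≤i (<⇒≤ i<j) , j≤n
  rx = proj₁ (spec i ri)
  ry = proj₁ (spec j rj)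
  rpx = prev-inRange T rx prev-x
  rpy = prev-inRange T ry prev-y
  a-inverse = ICA-inverse T ica rpx ICApx≡a
  b-inverse = ICA-inverse T ica rpy ICApy≡b
  CAi≢CAj : CA i ≢ CA j
  CAi≢CAj eq = <-irrefl (trans (sym (proj₁ ica i ri)) (trans (cong ICA eq) (proj₁ ica j rj))) i<j
  π≡ : π (conj T px) ≡ π (conj T py)
  π≡ = subst₂ (λ p q → π (conj T p) ≡ π (conj T q)) (proj₂ a-inverse) (proj₂ b-inverse) L≡
  from-order : Precedes T (CA i) (CA j) ⊎ Precedes T (CA j) (CA i) → a < b
  from-order (inj₁ CAi≺CAj) =
    ∸1-cancel-< (precedes⇒rank-< T rpx rpy (uncurry (rank T spec) a-inverse) (uncurry (rank T spec) b-inverse)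
                                 (prev-preserves-precedes T rx ry prev-x prev-y π≡ CAi≺CAj))
  from-order (inj₂ CAj≺CAi) =
    contradiction (precedes⇒rank-< T ry rx (rank T spec rj refl) (rank T spec ri refl) CAj≺CAi) (<⇒≯ (∸-monoˡ-< i<j 1≤i))
  ¬¬a<b : DoubleNegation (a < b)
  ¬¬a<b = do
    order ← ¬¬-precedes-total T CAi≢CAj
    pure (from-order order)
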